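{- Let $M_2\subseteq\mathbb{Z}$ and let $T$ be an admissible triangulation of the infinite strip $\mathbb{V}(\mathbb{Z},M_2)$ with no special marked point on its upper boundary, and let $t=\Phi(T)$. For all $i,j\in\mathbb{Z}$ with $i\le j$, we have $t(i,j)=1$ if and only if $j=i+1$ or there is a peripheral arc in $T$ from $(i,0)$ to $(j,0)$.
   Context: For $M_2\subseteq\mathbb{Z}$, $\mathbb{V}(\mathbb{Z},M_2)$ is the strip $\mathbb{R}\times[0,1]$ with marked points $(i,0)$, $i\in\mathbb{Z}$, on the lower boundary and $(i,1)$, $i\in M_2$, on the upper boundary. An arc is a non-contractible curve in the strip whose endpoints are marked points, up to isotopy fixing endpoints; boundary segments between consecutive marked points of the same boundary are not arcs. Bridging arcs have endpoints on different boundaries, peripheral arcs on the same boundary. A triangulation is a maximal collection of pairwise compatible (non-crossing) arcs. $T$ is admissible if every lower marked point is incident with only finitely many arcs of $T$. A marked point is special if incident with no arc of $T$. An infinite frieze is a map $t:\mathbb{Z}\times\mathbb{Z}\to\mathbb{Z}$ with $t(i,i)=0$; $t(i,j)\ge1$ for $i<j$ and $t(i,i+1)=1$; $t(i,j)=-t(j,i)$; and $t(i,j)t(i+1,j+1)-t(i,j+1)t(i+1,j)=1$ for all $i,j$; it is uniquely determined by its quiddity sequence $a_i=t(i-1,i+1)$. $\Phi(T)$ denotes the infinite frieze whose quiddity sequence is $a_i=$ number of triangles of $T$ incident with $(i,0)$. -}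

module Defs where

open import Data.Nat using (ℕ)
open import Data.Integer using (ℤ; +_; _+_; _-_; _*_; -_; _<_; _≤_; 0ℤ; 1ℤ)
open import Data.Product using (Σ; ∃; _×_)
open import Data.Sum using (_⊎_)
open import Data.Unit using (⊤)
open import Data.List using (List; length)
open import Data.List.Membership.Propositional using (_∈_)
open import Data.List.Relation.Unary.Unique.Propositional using (Unique)
open import Relation.Nullary using (¬_)
open import Relation.Binary.PropositionalEquality using (_≡_)
open import Function.Bundles using (_⇔_)

record IsInfiniteFrieze (t : ℤ → ℤ → ℤ) : Set where
  field
    diag    : ∀ i → t i i ≡ 0ℤ
    pos     : ∀ i j → i < j → 1ℤ ≤ t i j
    adj     : ∀ i → t i (i + 1ℤ) ≡ 1ℤ
    antisym : ∀ i j → t i j ≡ - t j i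
    diamond : ∀ i j →
      t i j * t (i + 1ℤ) (j + 1ℤ) - t i (j + 1ℤ) * t (i + 1ℤ) j ≡ 1ℤ

-- The strip V(ℤ, M₂).  M₂ is a subset of ℤ (a predicate).
-- Points: lo i = (i,0), up m = (m,1).

data Pt : Set where
  lo : ℤ → Pt
  up : ℤ → Pt

Marked : (ℤ → Set) → Pt → Set
Marked M₂ (lo i) = ⊤
Marked M₂ (up m) = M₂ m

-- The boundary of the strip (a disk with two boundary punctures at ±∞),
-- cut open at -∞, is linearly ordered: lower points from left to right,
-- then upper points from right to left.
data _◁_ : Pt → Pt → Set where
  ll : ∀ {i j} → i < j → lo i ◁ lo j
  lu : ∀ {i m} → lo i ◁ up m
  uu : ∀ {m m'} → m' < m → up m ◁ up m'

data BSeg (M₂ : ℤ → Set) : Pt → Pt → Set where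
  bl : ∀ {i} → BSeg M₂ (lo i) (lo (i + 1ℤ))
  bu : ∀ {m m'} → M₂ m → M₂ m' → m' < m →
       (∀ k → m' < k → k < m → ¬ M₂ k) → BSeg M₂ (up m) (up m')

-- Since the strip is contractible and all marked points lie on the
-- boundary, an isotopy class of arcs is determined by its (distinct)
-- endpoints; we record an arc by its endpoints p ◁ q.
IsArc : (ℤ → Set) → Pt → Pt → Set
IsArc M₂ p q = p ◁ q × Marked M₂ p × Marked M₂ q × ¬ BSeg M₂ p q

Cross : Pt → Pt → Pt → Pt → Set
Cross p q r s = (p ◁ r × r ◁ q × q ◁ s) ⊎ (r ◁ p × p ◁ s × s ◁ q)

-- A collection of arcs: T p q means the arc with endpoints p ◁ q is in T.
record IsTriangulation (M₂ : ℤ → Set) (T : Pt → Pt → Set) : Set where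
  field
    arcs       : ∀ p q → T p q → IsArc M₂ p q
    compatible : ∀ p q r s → T p q → T r s → ¬ Cross p q r s
    maximal    : ∀ p q → IsArc M₂ p q →
                 (∀ r s → T r s → ¬ Cross p q r s) → T p q

Incident : (T : Pt → Pt → Set) → Pt → Pt → Set
Incident T p q = T p q ⊎ T q p

Admissible : (T : Pt → Pt → Set) → Set
Admissible T = ∀ i → ∃ λ (L : List Pt) → ∀ q → Incident T (lo i) q → q ∈ L

NoSpecialUpper : (M₂ : ℤ → Set) → (T : Pt → Pt → Set) → Set
NoSpecialUpper M₂ T = ∀ m → M₂ m → ∃ λ q → Incident T (up m) q

Edge : (ℤ → Set) → (Pt → Pt → Set) → Pt → Pt → Set
Edge M₂ T p q = T p q ⊎ BSeg M₂ p q

TriangleAt : (ℤ → Set) → (Pt → Pt → Set) → ℤ → Pt × Pt × Pt → Set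
TriangleAt M₂ T i (a Data.Product., b Data.Product., c) =
  a ◁ b × b ◁ c × Edge M₂ T a b × Edge M₂ T b c × Edge M₂ T a c ×
  (a ≡ lo i ⊎ b ≡ lo i ⊎ c ≡ lo i)

NumTriangles : (ℤ → Set) → (Pt → Pt → Set) → ℤ → ℕ → Set
NumTriangles M₂ T i n =
  ∃ λ (L : List (Pt × Pt × Pt)) →
    Unique L × length L ≡ n × (∀ x → (x ∈ L ⇔ TriangleAt M₂ T i x))

-- t = Φ(T): the infinite frieze whose quiddity a_i = t(i-1,i+1) is the
-- number of triangles of T incident with (i,0)
IsΦ : (ℤ → Set) → (Pt → Pt → Set) → (ℤ → ℤ → ℤ) → Set
IsΦ M₂ T t = IsInfiniteFrieze t ×
  (∀ i → Σ ℕ λ n → NumTriangles M₂ T i n × t (i - 1ℤ) (i + 1ℤ) ≡ + n)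

module Submission where

-- The diamond rule alone forces every row and column of
--    t to satisfy t(x,j-1) + t(x,j+1) = a_j·t(x,j), and t satisfies the
--    Plücker relation t(x,a)t(b,c) + t(a,b)t(x,c) = t(x,b)t(a,c).  With
--    positivity this gives the apex lemma: if t(i,k) = 1 and i+1 < k, then
--    t(i,y) = t(y,k) = 1 for some i < y < k.
-- 2. Geometry.  Around a lower vertex y, angularly consecutive neighbours
--    are joined by an edge (maximality of T).  The triangles at y whose
--    other vertices lie in [y,k] (resp. [i,y]) form a fan; Plücker turns
--    each fan triangle into a step of a telescoping identity, so that
--    a_y = t(i,k) + |left fan| + |right fan| when t(i,y) = t(y,k) = 1.
-- 3. Counting, by strong induction on k - i.  (⇐) An arc (i,k) bounds a
--    triangle (i,y,k) whose apex y sees only the two fans and (i,y,k), so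
--    a_y ≤ |fans| + 1 and t(i,k) ≤ 1.  (⇒) If t(i,k) = 1, take y from the
--    apex lemma; were (i,k) not an arc, y would carry two triangles beyond
--    the fans, so a_y ≥ |fans| + 2 > t(i,k) + |fans|.
-- The non-constructive steps (maximality, nearest neighbours) run in the
-- double-negation monad; all conclusions drawn from them are stable.

open import Defs
open import Data.Integer using (ℤ; _+_; _≤_; 1ℤ)
open import Data.Sum using (_⊎_)
open import Relation.Binary.PropositionalEquality using (_≡_)
open import Function.Bundles using (_⇔_)

open import Data.Nat as ℕ using (ℕ; zero; suc)
import Data.Nat.Properties as ℕP
open import Data.Nat.Divisibility using (_∣_; ∣1⇒≡1; ∣m+n∣m⇒∣n; m∣m*n; n∣m*n)
open import Data.Nat.Induction using (<-rec)
import Data.Nat.Tactic.RingSolver as ℕSolver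
open import Data.Integer using (+_; -_; _-_; _*_; _<_; 0ℤ; ∣_∣; +≤+; +<+)
import Data.Integer.Properties as ℤP
open import Data.Integer.Tactic.RingSolver using (solve-∀)
open import Data.Product using (Σ; _,_; proj₁; proj₂; _×_)
open import Data.Sum using (inj₁; inj₂)
open import Data.Empty using (⊥; ⊥-elim)
open import Data.Unit using (tt)
open import Data.List using (List; []; _∷_; _++_; length)
open import Data.List.Membership.Propositional using (_∈_)
import Data.List.Membership.Propositional.Properties as ∈P
import Data.List.Properties as ListP
open import Data.List.Relation.Unary.Any using (here; there)
open import Data.List.Relation.Unary.All using (All; []; _∷_; tabulate)
open import Data.List.Relation.Unary.Unique.Propositional using (Unique; []; _∷_)
open import Data.List.Relation.Unary.Unique.Propositional.Properties using (++⁺)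
open import Function.Bundles using (Equivalence; mk⇔)
open import Relation.Binary.PropositionalEquality
  using (refl; sym; trans; cong; cong₂; subst; subst₂; _≢_; module ≡-Reasoning)
open import Relation.Binary.Definitions using (Tri; tri<; tri≈; tri>)
open import Relation.Nullary using (¬_; Dec; yes; no)
open import Relation.Nullary.Decidable using (decidable-stable)
open import Relation.Nullary.Negation using (¬¬-Monad)
open import Relation.Nullary.Decidable.Core using (¬¬-excluded-middle)
open import Effect.Monad using (RawMonad)
open import Level using (0ℓ)

open RawMonad (¬¬-Monad {0ℓ}) using (pure; _>>=_)

≤⇒+ℕ : ∀ {i j} → i ≤ j → Σ ℕ λ n → j ≡ i + + n
≤⇒+ℕ {i} {j} i≤j = ∣ j - i ∣ , (begin
    j                ≡⟨ j≡i+[j-i] i j ⟩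
    i + (j - i)      ≡⟨ cong (λ z → i + z) (sym (ℤP.0≤i⇒+∣i∣≡i (ℤP.i≤j⇒0≤j-i i≤j))) ⟩
    i + + ∣ j - i ∣  ∎)
  where
  open ≡-Reasoning
  j≡i+[j-i] : ∀ i j → j ≡ i + (j - i)
  j≡i+[j-i] = solve-∀

<⇒+1≤ : ∀ {i j} → i < j → i + 1ℤ ≤ j
<⇒+1≤ {i} {j} p = subst (_≤ j) (ℤP.+-comm 1ℤ i) (ℤP.i<j⇒suc[i]≤j p)

+1≤⇒< : ∀ {i j} → i + 1ℤ ≤ j → i < j
+1≤⇒< {i} {j} p = ℤP.suc[i]≤j⇒i<j (subst (_≤ j) (ℤP.+-comm i 1ℤ) p)

i<i+1 : ∀ i → i < i + 1ℤ
i<i+1 i = +1≤⇒< ℤP.≤-refl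

a+n+1 : ∀ a n → a + n + 1ℤ ≡ a + (1ℤ + n)
a+n+1 = solve-∀

i-1+1≡i : ∀ i → i - 1ℤ + 1ℤ ≡ i
i-1+1≡i = solve-∀

i+1-1≡i : ∀ i → i + 1ℤ - 1ℤ ≡ i
i+1-1≡i = solve-∀

i+0≡i : ∀ i → i + + 0 ≡ i
i+0≡i = solve-∀

i-0≡i : ∀ i → i - + 0 ≡ i
i-0≡i = solve-∀

i-1<i : ∀ i → i - 1ℤ < i
i-1<i i = +1≤⇒< (ℤP.≤-reflexive (i-1+1≡i i))

<+1⇒≤ : ∀ {x i} → x < i + 1ℤ → x ≤ i
<+1⇒≤ {x} {i} p = subst₂ _≤_ (i+1-1≡i x) (i+1-1≡i i) (ℤP.+-monoˡ-≤ (- 1ℤ) (<⇒+1≤ p))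

<⇒≤-1 : ∀ {x j} → x < j → x ≤ j - 1ℤ
<⇒≤-1 {x} {j} p = <+1⇒≤ (subst (x <_) (sym (i-1+1≡i j)) p)

noBetween : ∀ {i x} → i < x → x < i + 1ℤ → ⊥
noBetween {i} {x} p q = ℤP.<-irrefl refl (ℤP.<-≤-trans p (<+1⇒≤ q))

aboveOrBelow : ∀ x m → (Σ ℕ λ n → x ≡ m + + n) ⊎ (Σ ℕ λ n → x ≡ m - + n)
aboveOrBelow x m with ℤP.≤-total m x
... | inj₁ m≤x = inj₁ (≤⇒+ℕ m≤x)
... | inj₂ x≤m with ≤⇒+ℕ x≤m
...   | n , m≡x+n = inj₂ (n , trans (x≡x+n-n x (+ n)) (cong (_- + n) (sym m≡x+n)))
  where
  x≡x+n-n : ∀ x n → x ≡ x + n - n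
  x≡x+n-n = solve-∀

belowAtAbove : ∀ x j →
  (Σ ℕ λ n → x ≡ j - 1ℤ - + n) ⊎ x ≡ j ⊎ (Σ ℕ λ n → x ≡ j + 1ℤ + + n)
belowAtAbove x j with ℤP.<-cmp x j
... | tri≈ _ x≡j _ = inj₂ (inj₁ x≡j)
... | tri> _ _ j<x = inj₂ (inj₂ (≤⇒+ℕ (<⇒+1≤ j<x)))
... | tri< x<j _ _ with ≤⇒+ℕ (<⇒≤-1 x<j)
...   | n , j-1≡x+n = inj₁ (n , trans (x≡x+n-n x (+ n)) (cong (_- + n) (sym j-1≡x+n)))
  where
  x≡x+n-n : ∀ x n → x ≡ x + n - n
  x≡x+n-n = solve-∀

0≤⇒+ℕ : ∀ {z} → 0ℤ ≤ z → Σ ℕ λ n → z ≡ + n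
0≤⇒+ℕ {z} p = ∣ z ∣ , sym (ℤP.0≤i⇒+∣i∣≡i p)

cancelNonzero : ∀ x y → y ≢ 0ℤ → x * y ≡ 0ℤ → x ≡ 0ℤ
cancelNonzero x y y≢0 e with ℤP.i*j≡0⇒i≡0∨j≡0 x e
... | inj₁ x≡0 = x≡0
... | inj₂ y≡0 = ⊥-elim (y≢0 y≡0)

cancelSizes : ∀ {X A B} → X + A + B ≤ A + (1ℤ + B) → X ≤ 1ℤ
cancelSizes {X} {A} {B} p = subst₂ _≤_ (lhs X A B) (rhs A B) (ℤP.+-monoˡ-≤ (- A - B) p)
  where
  lhs : ∀ X A B → X + A + B + (- A - B) ≡ X
  lhs = solve-∀
  rhs : ∀ A B → A + (1ℤ + B) + (- A - B) ≡ 1ℤ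
  rhs = solve-∀

noRoomForTwo : ∀ {A B} → A + B + + 2 ≤ 1ℤ + A + B → ⊥
noRoomForTwo {A} {B} p with subst₂ _≤_ (lhs A B) (rhs A B) (ℤP.+-monoˡ-≤ (- A - B) p)
  where
  lhs : ∀ A B → A + B + + 2 + (- A - B) ≡ + 2
  lhs = solve-∀
  rhs : ∀ A B → 1ℤ + A + B + (- A - B) ≡ 1ℤ
  rhs = solve-∀
... | +≤+ (ℕ.s≤s ())

switch : (P : ℤ → Set) → (∀ x → Dec (P x)) → ∀ n a → ¬ P a → P (a + + n) →
         Σ ℤ λ x → a ≤ x × x + 1ℤ ≤ a + + n × ¬ P x × P (x + 1ℤ)
switch P P? zero a ¬Pa Pa+0 = ⊥-elim (¬Pa (subst P (i+0≡i a) Pa+0))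
switch P P? (suc n) a ¬Pa Pa+n+1 with P? (a + + n)
... | no ¬Pa+n = a + + n , ℤP.i≤i+j a (+ n) , ℤP.≤-reflexive (a+n+1 a (+ n)) ,
                 ¬Pa+n , subst P (sym (a+n+1 a (+ n))) Pa+n+1
... | yes Pa+n with switch P P? n a ¬Pa Pa+n
...   | x , a≤x , x+1≤a+n , ¬Px , Px+1 =
          x , a≤x , ℤP.≤-trans x+1≤a+n (ℤP.<⇒≤ a+n<a+[1+n]) , ¬Px , Px+1
  where
  a+n<a+[1+n] : a + + n < a + + suc n
  a+n<a+[1+n] = subst (a + + n <_) (a+n+1 a (+ n)) (i<i+1 (a + + n))

shorterSpan : ∀ {i k a b d} → k ≡ i + + d → i ≤ a → a < b → b ≤ k → (i < a ⊎ b < k) →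
              Σ ℕ λ e → b ≡ a + + e × e ℕ.< d
shorterSpan {i} {k} {a} {b} {d} k≡i+d i≤a a<b b≤k proper with ≤⇒+ℕ (ℤP.<⇒≤ a<b)
... | e , b≡a+e = e , b≡a+e , ℤP.drop‿+<+ (cancel (shift proper))
  where
  cancel : ∀ {x z} → i + x < i + z → x < z
  cancel {x} {z} p = subst₂ _<_ (-i+[i+x] i x) (-i+[i+x] i z) (ℤP.+-monoʳ-< (- i) p)
    where -i+[i+x] : ∀ i x → - i + (i + x) ≡ x
          -i+[i+x] = solve-∀
  shift : (i < a ⊎ b < k) → i + + e < i + + d
  shift (inj₁ i<a) = ℤP.<-≤-trans (ℤP.+-monoˡ-< (+ e) i<a) (subst₂ _≤_ b≡a+e k≡i+d b≤k)
  shift (inj₂ b<k) = ℤP.≤-<-trans (ℤP.+-monoˡ-≤ (+ e) i≤a) (subst₂ _<_ b≡a+e k≡i+d b<k)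

Recurrence : (ℤ → ℤ) → (ℤ → ℤ) → Set
Recurrence a F = ∀ n → F (n - 1ℤ) + F (n + 1ℤ) ≡ a n * F n

recurrenceCombination : ∀ a u v w p q r → Recurrence a u → Recurrence a v → Recurrence a w →
                        Recurrence a (λ n → p * u n + q * v n - r * w n)
recurrenceCombination a u v w p q r recU recV recW n = begin
  (p * u (n - 1ℤ) + q * v (n - 1ℤ) - r * w (n - 1ℤ)) + (p * u (n + 1ℤ) + q * v (n + 1ℤ) - r * w (n + 1ℤ))
    ≡⟨ regroup p q r (u (n - 1ℤ)) (u (n + 1ℤ)) (v (n - 1ℤ)) (v (n + 1ℤ)) (w (n - 1ℤ)) (w (n + 1ℤ)) ⟩
  p * (u (n - 1ℤ) + u (n + 1ℤ)) + q * (v (n - 1ℤ) + v (n + 1ℤ)) - r * (w (n - 1ℤ) + w (n + 1ℤ))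
    ≡⟨ cong₂ (λ x y → x - r * y) (cong₂ (λ x y → p * x + q * y) (recU n) (recV n)) (recW n) ⟩
  p * (a n * u n) + q * (a n * v n) - r * (a n * w n)
    ≡⟨ factor p q r (u n) (v n) (w n) (a n) ⟩
  a n * (p * u n + q * v n - r * w n) ∎
  where
  open ≡-Reasoning
  regroup : ∀ p q r u₁ u₂ v₁ v₂ w₁ w₂ →
            (p * u₁ + q * v₁ - r * w₁) + (p * u₂ + q * v₂ - r * w₂) ≡
            p * (u₁ + u₂) + q * (v₁ + v₂) - r * (w₁ + w₂)
  regroup = solve-∀
  factor : ∀ p q r u v w a → p * (a * u) + q * (a * v) - r * (a * w) ≡ a * (p * u + q * v - r * w)
  factor = solve-∀

module _ (a F : ℤ → ℤ) (rec : Recurrence a F) where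
  private
    Zero : ℤ → Set
    Zero z = F z ≡ 0ℤ

    sumZero : ∀ n → Zero n → F (n - 1ℤ) + F (n + 1ℤ) ≡ 0ℤ
    sumZero n Fn = trans (rec n) (trans (cong (a n *_) Fn) (ℤP.*-zeroʳ (a n)))

    forward : ∀ n → Zero (n - 1ℤ) → Zero n → Zero (n + 1ℤ)
    forward n p q = trans (sym (ℤP.+-identityˡ _)) (trans (cong (_+ F (n + 1ℤ)) (sym p)) (sumZero n q))

    backward : ∀ n → Zero n → Zero (n + 1ℤ) → Zero (n - 1ℤ)
    backward n p q = trans (sym (ℤP.+-identityʳ _)) (trans (cong (λ z → F (n - 1ℤ) + z) (sym q)) (sumZero n p))

  recurrenceVanishes : ∀ m → F m ≡ 0ℤ → F (m + 1ℤ) ≡ 0ℤ → ∀ n → F n ≡ 0ℤ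
  recurrenceVanishes m Fm Fm+1 n with aboveOrBelow n m
  ... | inj₁ (k , refl) = proj₁ (upward k)
    where
    upward : ∀ k → Zero (m + + k) × Zero (m + + k + 1ℤ)
    upward zero = subst Zero (sym (i+0≡i m)) Fm , subst (λ z → Zero (z + 1ℤ)) (sym (i+0≡i m)) Fm+1
    upward (suc k) with upward k
    ... | p , q = subst Zero (a+n+1 m (+ k)) q ,
                  subst (λ z → Zero (z + 1ℤ)) (a+n+1 m (+ k))
                        (forward (m + + k + 1ℤ) (subst Zero (sym (i+1-1≡i _)) p) q)
  ... | inj₂ (k , refl) = proj₁ (downward k)
    where
    m-k-1 : ∀ m k → m - k - 1ℤ ≡ m - (1ℤ + k)
    m-k-1 = solve-∀
    m-[1+k]+1 : ∀ m k → m - (1ℤ + k) + 1ℤ ≡ m - k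
    m-[1+k]+1 = solve-∀
    downward : ∀ k → Zero (m - + k) × Zero (m - + k + 1ℤ)
    downward zero = subst Zero (sym (i-0≡i m)) Fm , subst (λ z → Zero (z + 1ℤ)) (sym (i-0≡i m)) Fm+1
    downward (suc k) with downward k
    ... | p , q = subst Zero (m-k-1 m (+ k)) (backward (m - + k) p q) ,
                  subst Zero (sym (m-[1+k]+1 m (+ k))) p

module FriezeAlgebra {t : ℤ → ℤ → ℤ} (frieze : IsInfiniteFrieze t) where
  open IsInfiniteFrieze frieze

  quiddity : ℤ → ℤ
  quiddity j = t (j - 1ℤ) (j + 1ℤ)

  above-diagonal≢0 : ∀ {i j} → i < j → t i j ≢ 0ℤ
  above-diagonal≢0 {i} {j} i<j tij≡0 = ℤP.<-irrefl refl (ℤP.<-≤-trans (+<+ (ℕ.s≤s ℕ.z≤n)) 1≤0)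
    where 1≤0 : 1ℤ ≤ 0ℤ
          1≤0 = subst (1ℤ ≤_) tij≡0 (pos i j i<j)

  below-diagonal≢0 : ∀ {i j} → j < i → t i j ≢ 0ℤ
  below-diagonal≢0 {i} {j} j<i tij≡0 = above-diagonal≢0 j<i (trans (antisym j i) (cong -_ tij≡0))

  adjacent-left : ∀ j → t (j - 1ℤ) j ≡ 1ℤ
  adjacent-left j = subst (λ z → t (j - 1ℤ) z ≡ 1ℤ) (i-1+1≡i j) (adj (j - 1ℤ))

  adjacent-below : ∀ j → t (j + 1ℤ) j ≡ - 1ℤ
  adjacent-below j = trans (antisym (j + 1ℤ) j) (cong -_ (adj j))

  defect : ℤ → ℤ → ℤ
  defect j i = t i (j - 1ℤ) + t i (j + 1ℤ) - quiddity j * t i j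

  -- Two diamonds sharing the column j relate the defects of rows i and i+1.
  defect-step : ∀ j i → defect j i * t (i + 1ℤ) j ≡ defect j (i + 1ℤ) * t i j
  defect-step j i = begin
    (A + G - q * C) * B                             ≡⟨ expand A B C D E G q ⟩
    (D + E - q * B) * C + (A * B - C * D) - (C * E - G * B)
      ≡⟨ cong₂ (λ u v → (D + E - q * B) * C + u - v) diamond₁ (diamond i j) ⟩
    (D + E - q * B) * C + 1ℤ - 1ℤ                   ≡⟨ i+1-1≡i _ ⟩
    (D + E - q * B) * C                             ∎
    where
    open ≡-Reasoning
    A = t i (j - 1ℤ) ; B = t (i + 1ℤ) j ; C = t i j ; D = t (i + 1ℤ) (j - 1ℤ)
    E = t (i + 1ℤ) (j + 1ℤ) ; G = t i (j + 1ℤ) ; q = quiddity j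
    expand : ∀ A B C D E G q → (A + G - q * C) * B ≡
             (D + E - q * B) * C + (A * B - C * D) - (C * E - G * B)
    expand = solve-∀
    diamond₁ : A * B - C * D ≡ 1ℤ
    diamond₁ = subst (λ z → A * t (i + 1ℤ) z - t i z * D ≡ 1ℤ) (i-1+1≡i j) (diamond i (j - 1ℤ))

  -- The defect vanishes next to the diagonal and, by defect-step (the
  -- entries t(i+1,j), t(i,j) being nonzero off the diagonal), everywhere.
  defect-below : ∀ j n → defect j (j - 1ℤ - + n) ≡ 0ℤ
  defect-below j zero rewrite i-0≡i (j - 1ℤ) | diag (j - 1ℤ) | adjacent-left j = cancel (quiddity j)
    where cancel : ∀ q → 0ℤ + q - q * 1ℤ ≡ 0ℤ
          cancel = solve-∀
  defect-below j (suc n) = cancelNonzero (defect j i) (t (i + 1ℤ) j) (above-diagonal≢0 i+1<j)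
      (trans (defect-step j i) (trans (cong (λ z → defect j z * t i j) (shift j (+ n)))
                                      (cong (_* t i j) (defect-below j n))))
    where
    i = j - 1ℤ - (1ℤ + + n)
    shift : ∀ j n → j - 1ℤ - (1ℤ + n) + 1ℤ ≡ j - 1ℤ - n
    shift = solve-∀
    i+1<j : i + 1ℤ < j
    i+1<j = subst (_< j) (sym (shift j (+ n))) (ℤP.≤-<-trans (ℤP.i-j≤i (j - 1ℤ) (+ n)) (i-1<i j))

  defect-diagonal : ∀ j → defect j j ≡ 0ℤ
  defect-diagonal j rewrite antisym j (j - 1ℤ) | adjacent-left j | adj j | diag j = cancel (quiddity j)
    where cancel : ∀ q → - 1ℤ + 1ℤ - q * 0ℤ ≡ 0ℤ
          cancel = solve-∀

  defect-above : ∀ j n → defect j (j + 1ℤ + + n) ≡ 0ℤ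
  defect-above j zero rewrite i+0≡i (j + 1ℤ) | antisym (j + 1ℤ) (j - 1ℤ) | diag (j + 1ℤ)
                            | adjacent-below j = cancel (quiddity j)
    where cancel : ∀ q → - q + 0ℤ - q * - 1ℤ ≡ 0ℤ
          cancel = solve-∀
  defect-above j (suc n) = subst (λ z → defect j z ≡ 0ℤ) (a+n+1 (j + 1ℤ) (+ n))
      (cancelNonzero (defect j (i + 1ℤ)) (t i j) (below-diagonal≢0 j<i)
        (trans (sym (defect-step j i)) (cong (_* t (i + 1ℤ) j) (defect-above j n))))
    where
    i = j + 1ℤ + + n
    j<i : j < i
    j<i = ℤP.<-≤-trans (i<i+1 j) (ℤP.i≤i+j (j + 1ℤ) (+ n))

  defect-vanishes : ∀ j x → defect j x ≡ 0ℤ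
  defect-vanishes j x with belowAtAbove x j
  ... | inj₁ (n , refl) = defect-below j n
  ... | inj₂ (inj₁ refl) = defect-diagonal j
  ... | inj₂ (inj₂ (n , refl)) = defect-above j n

  row-recurrence : ∀ x → Recurrence quiddity (t x)
  row-recurrence x j = ℤP.i-j≡0⇒i≡j _ _ (defect-vanishes j x)

  column-recurrence : ∀ y → Recurrence quiddity (λ x → t x y)
  column-recurrence y j = begin
    t (j - 1ℤ) y + t (j + 1ℤ) y      ≡⟨ cong₂ _+_ (antisym (j - 1ℤ) y) (antisym (j + 1ℤ) y) ⟩
    - t y (j - 1ℤ) + - t y (j + 1ℤ)  ≡⟨ sym (ℤP.neg-distrib-+ (t y (j - 1ℤ)) (t y (j + 1ℤ))) ⟩
    - (t y (j - 1ℤ) + t y (j + 1ℤ))  ≡⟨ cong -_ (row-recurrence y j) ⟩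
    - (quiddity j * t y j)           ≡⟨ ℤP.neg-distribʳ-* (quiddity j) (t y j) ⟩
    quiddity j * - t y j             ≡⟨ cong (quiddity j *_) (sym (antisym j y)) ⟩
    quiddity j * t j y               ∎
    where open ≡-Reasoning

  -- As a function of C both sides solve
  -- the row recurrence, and they agree at C = B and C = B+1; the latter is
  -- itself a Plücker relation in A, proved the same way.
  plucker : ∀ X A B C → t X A * t B C + t A B * t X C ≡ t X B * t A C
  plucker X A B C = ℤP.i-j≡0⇒i≡j _ _ (gapVanishes C)
    where
    gap₁ : ℤ → ℤ
    gap₁ A' = t B (B + 1ℤ) * t X A' + t X (B + 1ℤ) * t A' B - t X B * t A' (B + 1ℤ)
    gap₁Vanishes : ∀ A' → gap₁ A' ≡ 0ℤ
    gap₁Vanishes = recurrenceVanishes quiddity gap₁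
      (recurrenceCombination quiddity (t X) (λ x → t x B) (λ x → t x (B + 1ℤ))
        (t B (B + 1ℤ)) (t X (B + 1ℤ)) (t X B)
        (row-recurrence X) (column-recurrence B) (column-recurrence (B + 1ℤ)))
      B atB atB+1
      where
      atB : gap₁ B ≡ 0ℤ
      atB rewrite diag B = cancel (t B (B + 1ℤ)) (t X B) (t X (B + 1ℤ))
        where cancel : ∀ a b c → a * b + c * 0ℤ - b * a ≡ 0ℤ
              cancel = solve-∀
      atB+1 : gap₁ (B + 1ℤ) ≡ 0ℤ
      atB+1 rewrite diag (B + 1ℤ) | antisym (B + 1ℤ) B = cancel (t B (B + 1ℤ)) (t X B) (t X (B + 1ℤ))
        where cancel : ∀ a b c → a * c + c * - a - b * 0ℤ ≡ 0ℤ
              cancel = solve-∀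
    gap : ℤ → ℤ
    gap C' = t X A * t B C' + t A B * t X C' - t X B * t A C'
    gapVanishes : ∀ C' → gap C' ≡ 0ℤ
    gapVanishes = recurrenceVanishes quiddity gap
      (recurrenceCombination quiddity (t B) (t X) (t A) (t X A) (t A B) (t X B)
        (row-recurrence B) (row-recurrence X) (row-recurrence A))
      B atB atB+1
      where
      atB : gap B ≡ 0ℤ
      atB rewrite diag B = cancel (t X A) (t A B) (t X B)
        where cancel : ∀ a b c → a * 0ℤ + b * c - c * b ≡ 0ℤ
              cancel = solve-∀
      atB+1 : gap (B + 1ℤ) ≡ 0ℤ
      atB+1 = trans (reorder (t X A) (t A B) (t X B) (t B (B + 1ℤ)) (t X (B + 1ℤ)) (t A (B + 1ℤ)))
                    (gap₁Vanishes A)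
        where reorder : ∀ a b c d e f → a * d + b * e - c * f ≡ d * a + e * b - c * f
              reorder = solve-∀

-- Arithmetic core: natural numbers with b < a, a' ≤ b' and
-- b·a' + 1 = b'·a.  Either a' < b', and then (a'+1)(b+1) ≤ b'·a forces
-- a' = b = 0; or a' = b', and then b' divides 1.
apexArithmetic : ∀ b a b' a' → b ℕ.< a → a' ℕ.≤ b' → b ℕ.* a' ℕ.+ 1 ≡ b' ℕ.* a →
                 (b ≡ 0 × a' ≡ 0) ⊎ (b' ≡ 1 × a' ≡ 1)
apexArithmetic b a b' a' b<a a'≤b' eq with ℕP.m≤n⇒m<n∨m≡n a'≤b'
... | inj₁ a'<b' = inj₁ (ℕP.m+n≡0⇒n≡0 a' a'+b≡0 , ℕP.m+n≡0⇒m≡0 a' a'+b≡0)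
  where
  expand : ∀ a' b → suc a' ℕ.* suc b ≡ (b ℕ.* a' ℕ.+ 1) ℕ.+ (a' ℕ.+ b)
  expand = ℕSolver.solve-∀
  bound : (b ℕ.* a' ℕ.+ 1) ℕ.+ (a' ℕ.+ b) ℕ.≤ (b ℕ.* a' ℕ.+ 1) ℕ.+ 0
  bound = subst₂ ℕ._≤_ (expand a' b) (trans (sym eq) (sym (ℕP.+-identityʳ _)))
                 (ℕP.*-mono-≤ a'<b' b<a)
  a'+b≡0 : a' ℕ.+ b ≡ 0
  a'+b≡0 = ℕP.n≤0⇒n≡0 (ℕP.+-cancelˡ-≤ (b ℕ.* a' ℕ.+ 1) _ _ bound)
... | inj₂ refl = inj₂ (b'≡1 , b'≡1)
  where
  b'≡1 : b' ≡ 1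
  b'≡1 = ∣1⇒≡1 (∣m+n∣m⇒∣n (subst (b' ∣_) (sym eq) (m∣m*n a)) (n∣m*n b))

module Apex {t : ℤ → ℤ → ℤ} (frieze : IsInfiniteFrieze t) where
  open IsInfiniteFrieze frieze
  open FriezeAlgebra frieze

  natural : ∀ {a b} → a ≤ b → Σ ℕ λ n → t a b ≡ + n
  natural {a} {b} a≤b with ℤP.<-cmp a b
  ... | tri< a<b _ _ = 0≤⇒+ℕ (ℤP.≤-trans (+≤+ ℕ.z≤n) (pos a b a<b))
  ... | tri≈ _ refl _ = 0 , diag a
  ... | tri> _ _ b<a = ⊥-elim (ℤP.<-irrefl refl (ℤP.<-≤-trans b<a a≤b))

  vanishing⇒diagonal : ∀ {a b} → a ≤ b → t a b ≡ 0ℤ → a ≡ b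
  vanishing⇒diagonal {a} {b} a≤b tab≡0 with ℤP.<-cmp a b
  ... | tri< a<b _ _ = ⊥-elim (above-diagonal≢0 a<b tab≡0)
  ... | tri≈ _ a≡b _ = a≡b
  ... | tri> _ _ b<a = ⊥-elim (ℤP.<-irrefl refl (ℤP.<-≤-trans b<a a≤b))

  -- If t(i,k) = 1 with k > i+1, some y strictly between has
  -- t(i,y) = t(y,k) = 1.  Moving x from i to k, the comparison
  -- t(x,k) ≤ t(i,x) switches at some step x, x+1; Plücker for
  -- i, x, x+1, k then pins down t(i,x+1) = t(x+1,k) = 1.
  apex : ∀ i k → i + 1ℤ < k → t i k ≡ 1ℤ → Σ ℤ λ y → i < y × y < k × t i y ≡ 1ℤ × t y k ≡ 1ℤ
  apex i k i+1<k tik≡1 with ≤⇒+ℕ (ℤP.<⇒≤ (ℤP.<-trans (i<i+1 i) i+1<k))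
  ... | n , k≡i+n with switch (λ x → t x k ≤ t i x) (λ x → t x k ℤP.≤? t i x) n i ¬P[i] P[k]
    where
    ¬P[i] : ¬ (t i k ≤ t i i)
    ¬P[i] tik≤tii rewrite tik≡1 | diag i = ℤP.<-irrefl refl (ℤP.<-≤-trans (+<+ (ℕ.s≤s ℕ.z≤n)) tik≤tii)
    P[k] : t (i + + n) k ≤ t i (i + + n)
    P[k] rewrite sym k≡i+n | diag k | tik≡1 = +≤+ ℕ.z≤n
  ... | x , i≤x , x+1≤i+n , ¬P[x] , P[x+1] =
        atSwitch (natural i≤x) (natural x≤k) (natural (ℤP.≤-trans i≤x (ℤP.<⇒≤ (i<i+1 x)))) (natural x+1≤k)
    where
    x+1≤k : x + 1ℤ ≤ k
    x+1≤k = subst (x + 1ℤ ≤_) (sym k≡i+n) x+1≤i+n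
    x≤k : x ≤ k
    x≤k = ℤP.<⇒≤ (ℤP.<-≤-trans (i<i+1 x) x+1≤k)
    -- Plücker for i < x < x+1 < k, using t(x,x+1) = t(i,k) = 1
    plucker₁ : t i x * t (x + 1ℤ) k + 1ℤ ≡ t i (x + 1ℤ) * t x k
    plucker₁ = trans (cong₂ (λ u v → t i x * t (x + 1ℤ) k + u * v) (sym (adj x)) (sym tik≡1))
                     (plucker i x (x + 1ℤ) k)
    atSwitch : (Σ ℕ λ b → t i x ≡ + b) → (Σ ℕ λ a → t x k ≡ + a) →
               (Σ ℕ λ b' → t i (x + 1ℤ) ≡ + b') → (Σ ℕ λ a' → t (x + 1ℤ) k ≡ + a') →
               Σ ℤ λ y → i < y × y < k × t i y ≡ 1ℤ × t y k ≡ 1ℤ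
    atSwitch (b , tix≡b) (a , txk≡a) (b' , tix'≡b') (a' , tx'k≡a')
      with apexArithmetic b a b' a' b<a a'≤b' arithmetic
      where
      b<a : b ℕ.< a
      b<a = ℤP.drop‿+<+ (subst₂ _<_ tix≡b txk≡a (ℤP.≰⇒> ¬P[x]))
      a'≤b' : a' ℕ.≤ b'
      a'≤b' = ℤP.drop‿+≤+ (subst₂ _≤_ tx'k≡a' tix'≡b' P[x+1])
      arithmetic : b ℕ.* a' ℕ.+ 1 ≡ b' ℕ.* a
      arithmetic = ℤP.+-injective (begin
        + (b ℕ.* a' ℕ.+ 1)        ≡⟨ ℤP.pos-+ (b ℕ.* a') 1 ⟩
        + (b ℕ.* a') + 1ℤ         ≡⟨ cong (_+ 1ℤ) (ℤP.pos-* b a') ⟩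
        + b * + a' + 1ℤ           ≡⟨ cong₂ (λ u v → u * v + 1ℤ) (sym tix≡b) (sym tx'k≡a') ⟩
        t i x * t (x + 1ℤ) k + 1ℤ ≡⟨ plucker₁ ⟩
        t i (x + 1ℤ) * t x k      ≡⟨ cong₂ _*_ tix'≡b' txk≡a ⟩
        + b' * + a                ≡⟨ sym (ℤP.pos-* b' a) ⟩
        + (b' ℕ.* a)              ∎)
        where open ≡-Reasoning
    ... | inj₁ (b≡0 , a'≡0) = ⊥-elim (ℤP.<-irrefl i+1≡k i+1<k)
      where
      i≡x : i ≡ x
      i≡x = vanishing⇒diagonal i≤x (trans tix≡b (cong +_ b≡0))
      i+1≡k : i + 1ℤ ≡ k
      i+1≡k = trans (cong (_+ 1ℤ) i≡x) (vanishing⇒diagonal x+1≤k (trans tx'k≡a' (cong +_ a'≡0)))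
    ... | inj₂ (b'≡1 , a'≡1) = x + 1ℤ , ℤP.≤-<-trans i≤x (i<i+1 x) , x+1<k , tix'≡1 , tx'k≡1
      where
      tix'≡1 : t i (x + 1ℤ) ≡ 1ℤ
      tix'≡1 = trans tix'≡b' (cong +_ b'≡1)
      tx'k≡1 : t (x + 1ℤ) k ≡ 1ℤ
      tx'k≡1 = trans tx'k≡a' (cong +_ a'≡1)
      x+1<k : x + 1ℤ < k
      x+1<k = ℤP.≤∧≢⇒< x+1≤k (λ x+1≡k → 0≢1 (trans (sym (diag k)) (subst (λ z → t z k ≡ 1ℤ) x+1≡k tx'k≡1)))
        where 0≢1 : 0ℤ ≢ 1ℤ
              0≢1 ()

∈-tail : ∀ {A : Set} {m x : A} {M} → x ≢ m → x ∈ m ∷ M → x ∈ M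
∈-tail x≢m (here x≡m) = ⊥-elim (x≢m x≡m)
∈-tail x≢m (there x∈M) = x∈M

¬¬-minimal : ∀ {A : Set} (R : A → A → Set) → (∀ {x} → ¬ R x x) →
             (∀ {x y z} → R x y → R y z → R x z) →
             (P : A → Set) (M : List A) (cand : A) → P cand →
             (∀ x → P x → R x cand → x ∈ M) →
             ¬ ¬ (Σ A λ z → P z × (z ≡ cand ⊎ R z cand) × (∀ x → P x → R x z → ⊥))
¬¬-minimal R irr trans' P [] cand Pc below∈ =
  pure (cand , Pc , inj₁ refl , λ x Px Rxc → absurd (below∈ x Px Rxc))
  where absurd : ∀ {x} → x ∈ [] → ⊥
        absurd ()
¬¬-minimal R irr trans' P (m ∷ M) cand Pc below∈ = ¬¬-excluded-middle {A = P m × R m cand} >>= λ where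
  (yes (Pm , Rmc)) →
    ¬¬-minimal R irr trans' P M m Pm
               (λ x Px Rxm → ∈-tail (λ { refl → irr Rxm }) (below∈ x Px (trans' Rxm Rmc))) >>= λ where
      (z , Pz , inj₁ refl , minimal) → pure (z , Pz , inj₂ Rmc , minimal)
      (z , Pz , inj₂ Rzm , minimal) → pure (z , Pz , inj₂ (trans' Rzm Rmc) , minimal)
  (no ¬[Pm×Rmc]) → ¬¬-minimal R irr trans' P M cand Pc λ x Px Rxc →
      ∈-tail (λ x≡m → ¬[Pm×Rmc] (subst P x≡m Px , subst (λ w → R w cand) x≡m Rxc)) (below∈ x Px Rxc)

unique⊆⇒length≤ : ∀ {A : Set} (xs ys : List A) → Unique xs → (∀ x → x ∈ xs → x ∈ ys) →
                  length xs ℕ.≤ length ys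
unique⊆⇒length≤ [] ys _ _ = ℕ.z≤n
unique⊆⇒length≤ (x ∷ xs) ys (x∉xs ∷ uxs) xs⊆ys with ∈P.∈-∃++ (xs⊆ys x (here refl))
... | pre , post , refl = subst (suc (length xs) ℕ.≤_) (sym length-removed)
                                (ℕ.s≤s (unique⊆⇒length≤ xs (pre ++ post) uxs xs⊆rest))
  where
  length-removed : length (pre ++ x ∷ post) ≡ suc (length (pre ++ post))
  length-removed = trans (ListP.length-++ pre)
    (trans (ℕP.+-suc (length pre) (length post)) (cong suc (sym (ListP.length-++ pre))))
  distinct : ∀ {z} → z ∈ xs → z ≢ x
  distinct z∈xs refl = go x∉xs z∈xs
    where go : ∀ {ws} → All (x ≢_) ws → x ∈ ws → ⊥
          go (x≢w ∷ _) (here x≡w) = x≢w x≡w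
          go (_ ∷ x∉ws) (there x∈ws) = go x∉ws x∈ws
  xs⊆rest : ∀ z → z ∈ xs → z ∈ pre ++ post
  xs⊆rest z z∈xs with ∈P.∈-++⁻ pre (xs⊆ys z (there z∈xs))
  ... | inj₁ z∈pre = ∈P.∈-++⁺ˡ z∈pre
  ... | inj₂ (here z≡x) = ⊥-elim (distinct z∈xs z≡x)
  ... | inj₂ (there z∈post) = ∈P.∈-++⁺ʳ pre z∈post

lo-injective : ∀ {i j} → lo i ≡ lo j → i ≡ j
lo-injective refl = refl

up-injective : ∀ {i j} → up i ≡ up j → i ≡ j
up-injective refl = refl

◁-irrefl : ∀ {p} → ¬ (p ◁ p)
◁-irrefl (ll i<i) = ℤP.<-irrefl refl i<i
◁-irrefl (uu m<m) = ℤP.<-irrefl refl m<m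

◁-trans : ∀ {p q r} → p ◁ q → q ◁ r → p ◁ r
◁-trans (ll i<j) (ll j<k) = ll (ℤP.<-trans i<j j<k)
◁-trans (ll _) lu = lu
◁-trans lu (uu _) = lu
◁-trans (uu m'<m) (uu m''<m') = uu (ℤP.<-trans m''<m' m'<m)

◁-asym : ∀ {p q} → p ◁ q → q ◁ p → ⊥
◁-asym p◁q q◁p = ◁-irrefl (◁-trans p◁q q◁p)

◁-cmp : ∀ p q → Tri (p ◁ q) (p ≡ q) (q ◁ p)
◁-cmp (lo i) (lo j) with ℤP.<-cmp i j
... | tri< i<j i≢j _ = tri< (ll i<j) (λ e → i≢j (lo-injective e)) (λ { (ll j<i) → ◁-asym (ll i<j) (ll j<i) })
... | tri≈ _ refl _ = tri≈ ◁-irrefl refl ◁-irrefl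
... | tri> _ i≢j j<i = tri> (λ { (ll i<j) → ◁-asym (ll i<j) (ll j<i) }) (λ e → i≢j (lo-injective e)) (ll j<i)
◁-cmp (lo i) (up m) = tri< lu (λ ()) (λ ())
◁-cmp (up m) (lo i) = tri> (λ ()) (λ ()) lu
◁-cmp (up m) (up m') with ℤP.<-cmp m m'
... | tri< m<m' m≢m' _ = tri> (λ { (uu m'<m) → ◁-asym (uu m'<m) (uu m<m') }) (λ e → m≢m' (up-injective e)) (uu m<m')
... | tri≈ _ refl _ = tri≈ ◁-irrefl refl ◁-irrefl
... | tri> _ m≢m' m'<m = tri< (uu m'<m) (λ e → m≢m' (up-injective e)) (λ { (uu m<m') → ◁-asym (uu m'<m) (uu m<m') })

lo◁lo⇒< : ∀ {i j} → lo i ◁ lo j → i < j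
lo◁lo⇒< (ll i<j) = i<j

segment-from-lo : ∀ {M₂ : ℤ → Set} {i p} → BSeg M₂ (lo i) p → p ≡ lo (i + 1ℤ)
segment-from-lo bl = refl

segment-to-lo : ∀ {M₂ : ℤ → Set} {i p} → BSeg M₂ p (lo i) → p ≡ lo (i - 1ℤ)
segment-to-lo {i = i} (bl {j}) = cong lo (sym (i+1-1≡i j))

segment-before : ∀ {M₂ : ℤ → Set} i → BSeg M₂ (lo (i - 1ℤ)) (lo i)
segment-before {M₂} i = subst (λ z → BSeg M₂ (lo (i - 1ℤ)) (lo z)) (i-1+1≡i i) bl

module StripGeometry (M₂ : ℤ → Set) (T : Pt → Pt → Set) (triangulation : IsTriangulation M₂ T) where
  open IsTriangulation triangulation

  Ed : Pt → Pt → Set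
  Ed = Edge M₂ T

  Neighbour : Pt → Pt → Set
  Neighbour c x = Ed c x ⊎ Ed x c

  edge◁ : ∀ {p q} → Ed p q → p ◁ q
  edge◁ (inj₁ τ) = proj₁ (arcs _ _ τ)
  edge◁ (inj₂ bl) = ll (i<i+1 _)
  edge◁ (inj₂ (bu _ _ m'<m _)) = uu m'<m

  edge-markedˡ : ∀ {p q} → Ed p q → Marked M₂ p
  edge-markedˡ (inj₁ τ) = proj₁ (proj₂ (arcs _ _ τ))
  edge-markedˡ (inj₂ bl) = tt
  edge-markedˡ (inj₂ (bu Mm _ _ _)) = Mm

  edge-markedʳ : ∀ {p q} → Ed p q → Marked M₂ q
  edge-markedʳ (inj₁ τ) = proj₁ (proj₂ (proj₂ (arcs _ _ τ)))
  edge-markedʳ (inj₂ bl) = tt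
  edge-markedʳ (inj₂ (bu _ Mm' _ _)) = Mm'

  neighbour-marked : ∀ {c x} → Neighbour c x → Marked M₂ x
  neighbour-marked (inj₁ e) = edge-markedʳ e
  neighbour-marked (inj₂ e) = edge-markedˡ e

  neighbour-after : ∀ {c x} → Neighbour c x → c ◁ x → Ed c x
  neighbour-after (inj₁ e) _ = e
  neighbour-after (inj₂ e) c◁x = ⊥-elim (◁-asym c◁x (edge◁ e))

  neighbour-before : ∀ {c x} → Neighbour c x → x ◁ c → Ed x c
  neighbour-before (inj₁ e) x◁c = ⊥-elim (◁-asym x◁c (edge◁ e))
  neighbour-before (inj₂ e) _ = e

  edge⇒arc : ∀ {a b} → Ed (lo a) (lo b) → a + 1ℤ < b → T (lo a) (lo b)
  edge⇒arc (inj₁ τ) _ = τ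
  edge⇒arc (inj₂ s) a+1<b = ⊥-elim (ℤP.<-irrefl (sym (lo-injective (segment-from-lo s))) a+1<b)

  segment-empty : ∀ {a b x} → BSeg M₂ a b → a ◁ x → x ◁ b → Marked M₂ x → ⊥
  segment-empty bl (ll i<x) (ll x<i+1) _ = noBetween i<x x<i+1
  segment-empty (bu _ _ _ gap) (uu x<m) (uu m'<x) Mx = gap _ m'<x x<m Mx

  edge-noncrossing : ∀ {a b r s} → Ed a b → T r s → ¬ Cross a b r s
  edge-noncrossing (inj₁ τ) τ' cr = compatible _ _ _ _ τ τ' cr
  edge-noncrossing (inj₂ seg) τ' (inj₁ (a◁r , r◁b , _)) = segment-empty seg a◁r r◁b (edge-markedˡ (inj₁ τ'))
  edge-noncrossing (inj₂ seg) τ' (inj₂ (_ , a◁s , s◁b)) = segment-empty seg a◁s s◁b (edge-markedʳ (inj₁ τ'))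

  ¬¬-edge : ∀ a b → a ◁ b → Marked M₂ a → Marked M₂ b → (∀ r s → T r s → ¬ Cross a b r s) → ¬ ¬ Ed a b
  ¬¬-edge a b a◁b Ma Mb noncrossing = ¬¬-excluded-middle {A = BSeg M₂ a b} >>= λ where
    (yes seg) → pure (inj₂ seg)
    (no ¬seg) → pure (inj₁ (maximal a b (a◁b , Ma , Mb , ¬seg) noncrossing))

  -- Membership in T is stable under double negation: an arc that is not
  -- refuted crosses no arc of T, hence belongs to T by maximality.
  ¬¬-arc : ∀ {p q} → IsArc M₂ p q → ¬ ¬ T p q → T p q
  ¬¬-arc {p} {q} arc ¬¬τ = maximal p q arc (λ r s τ' cr → ¬¬τ (λ τ → compatible p q r s τ τ' cr))

  -- The angular order around c: p before q when turning around c from its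
  -- right-hand boundary direction to its left-hand one.
  Ang : Pt → Pt → Pt → Set
  Ang c p q = (c ◁ p × c ◁ q × p ◁ q) ⊎ (c ◁ p × q ◁ c) ⊎ (p ◁ c × q ◁ c × p ◁ q)

  Ang-irrefl : ∀ {c p} → ¬ Ang c p p
  Ang-irrefl (inj₁ (_ , _ , p◁p)) = ◁-irrefl p◁p
  Ang-irrefl (inj₂ (inj₁ (c◁p , p◁c))) = ◁-asym c◁p p◁c
  Ang-irrefl (inj₂ (inj₂ (_ , _ , p◁p))) = ◁-irrefl p◁p

  Ang-trans : ∀ {c p q r} → Ang c p q → Ang c q r → Ang c p r
  Ang-trans (inj₁ (c◁p , _ , p◁q)) (inj₁ (_ , c◁r , q◁r)) = inj₁ (c◁p , c◁r , ◁-trans p◁q q◁r)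
  Ang-trans (inj₁ (c◁p , _ , _)) (inj₂ (inj₁ (_ , r◁c))) = inj₂ (inj₁ (c◁p , r◁c))
  Ang-trans (inj₁ (_ , c◁q , _)) (inj₂ (inj₂ (q◁c , _ , _))) = ⊥-elim (◁-asym c◁q q◁c)
  Ang-trans (inj₂ (inj₁ (_ , q◁c))) (inj₁ (c◁q , _ , _)) = ⊥-elim (◁-asym c◁q q◁c)
  Ang-trans (inj₂ (inj₁ (_ , q◁c))) (inj₂ (inj₁ (c◁q , _))) = ⊥-elim (◁-asym c◁q q◁c)
  Ang-trans (inj₂ (inj₁ (c◁p , _))) (inj₂ (inj₂ (_ , r◁c , _))) = inj₂ (inj₁ (c◁p , r◁c))
  Ang-trans (inj₂ (inj₂ (_ , q◁c , _))) (inj₁ (c◁q , _ , _)) = ⊥-elim (◁-asym c◁q q◁c)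
  Ang-trans (inj₂ (inj₂ (_ , q◁c , _))) (inj₂ (inj₁ (c◁q , _))) = ⊥-elim (◁-asym c◁q q◁c)
  Ang-trans (inj₂ (inj₂ (p◁c , _ , p◁q))) (inj₂ (inj₂ (_ , r◁c , q◁r))) = inj₂ (inj₂ (p◁c , r◁c , ◁-trans p◁q q◁r))

  last-before⇒adjacent : ∀ {c q k} → c ◁ q → c ◁ k →
                         (∀ x → Neighbour c x × (c ◁ x × x ◁ k) → q ◁ x → ⊥) →
                         ∀ x → Neighbour c x → Ang c q x → Ang c x k → ⊥
  last-before⇒adjacent _ _ last x nx (inj₁ (_ , c◁x , q◁x)) (inj₁ (_ , _ , x◁k)) = last x (nx , c◁x , x◁k) q◁x
  last-before⇒adjacent _ c◁k _ _ _ (inj₁ _) (inj₂ (inj₁ (_ , k◁c))) = ◁-asym c◁k k◁c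
  last-before⇒adjacent _ _ _ _ _ (inj₁ (_ , c◁x , _)) (inj₂ (inj₂ (x◁c , _ , _))) = ◁-asym c◁x x◁c
  last-before⇒adjacent _ _ _ _ _ (inj₂ (inj₁ (_ , x◁c))) (inj₁ (c◁x , _ , _)) = ◁-asym c◁x x◁c
  last-before⇒adjacent _ _ _ _ _ (inj₂ (inj₁ (_ , x◁c))) (inj₂ (inj₁ (c◁x , _))) = ◁-asym c◁x x◁c
  last-before⇒adjacent _ c◁k _ _ _ (inj₂ (inj₁ _)) (inj₂ (inj₂ (_ , k◁c , _))) = ◁-asym c◁k k◁c
  last-before⇒adjacent c◁q _ _ _ _ (inj₂ (inj₂ (q◁c , _ , _))) _ = ◁-asym c◁q q◁c

  first-after⇒adjacent : ∀ {c i q} → i ◁ c →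
                         (∀ x → Neighbour c x × (x ◁ c × i ◁ x) → x ◁ q → ⊥) →
                         ∀ x → Neighbour c x → Ang c i x → Ang c x q → ⊥
  first-after⇒adjacent i◁c _ _ _ (inj₁ (c◁i , _ , _)) _ = ◁-asym c◁i i◁c
  first-after⇒adjacent i◁c _ _ _ (inj₂ (inj₁ (c◁i , _))) _ = ◁-asym c◁i i◁c
  first-after⇒adjacent _ _ _ _ (inj₂ (inj₂ (_ , x◁c , _))) (inj₁ (c◁x , _ , _)) = ◁-asym c◁x x◁c
  first-after⇒adjacent _ _ _ _ (inj₂ (inj₂ (_ , x◁c , _))) (inj₂ (inj₁ (c◁x , _))) = ◁-asym c◁x x◁c
  first-after⇒adjacent _ first x nx (inj₂ (inj₂ (_ , x◁c , i◁x))) (inj₂ (inj₂ (_ , _ , x◁q))) =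
    first x (nx , x◁c , i◁x) x◁q

  -- Two neighbours of c that are consecutive in the angular order are
  -- joined by an edge: an arc crossing pq would have to cross one of the
  -- edges cp, cq, or else be an arc at c strictly between p and q.
  consecutive⇒edge : ∀ {c p q} → Neighbour c p → Neighbour c q → Ang c p q →
                     (∀ x → Neighbour c x → Ang c p x → Ang c x q → ⊥) → ¬ ¬ (Ed p q ⊎ Ed q p)
  consecutive⇒edge {c} {p} {q} np nq (inj₁ (c◁p , c◁q , p◁q)) between =
    ¬¬-edge p q p◁q (neighbour-marked np) (neighbour-marked nq) noncrossing >>= λ e → pure (inj₁ e)
    where
    noncrossing : ∀ r s → T r s → ¬ Cross p q r s
    noncrossing r s τ (inj₁ (p◁r , r◁q , q◁s)) =
      edge-noncrossing (neighbour-after nq c◁q) τ (inj₁ (◁-trans c◁p p◁r , r◁q , q◁s))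
    noncrossing r s τ (inj₂ (r◁p , p◁s , s◁q)) with ◁-cmp r c
    ... | tri< r◁c _ _ = edge-noncrossing (neighbour-after nq c◁q) τ (inj₂ (r◁c , ◁-trans c◁p p◁s , s◁q))
    ... | tri≈ _ refl _ = between s (inj₁ (inj₁ τ)) (inj₁ (c◁p , ◁-trans c◁p p◁s , p◁s))
                                  (inj₁ (◁-trans c◁p p◁s , c◁q , s◁q))
    ... | tri> _ _ c◁r = edge-noncrossing (neighbour-after np c◁p) τ (inj₁ (c◁r , r◁p , p◁s))
  consecutive⇒edge {c} {p} {q} np nq (inj₂ (inj₁ (c◁p , q◁c))) between =
    ¬¬-edge q p (◁-trans q◁c c◁p) (neighbour-marked nq) (neighbour-marked np) noncrossing >>= λ e → pure (inj₂ e)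
    where
    noncrossing : ∀ r s → T r s → ¬ Cross q p r s
    noncrossing r s τ (inj₁ (q◁r , r◁p , p◁s)) with ◁-cmp r c
    ... | tri< r◁c _ _ = edge-noncrossing (neighbour-before nq q◁c) τ (inj₁ (q◁r , r◁c , ◁-trans c◁p p◁s))
    ... | tri≈ _ refl _ = between s (inj₁ (inj₁ τ)) (inj₁ (c◁p , ◁-trans c◁p p◁s , p◁s))
                                  (inj₂ (inj₁ (◁-trans c◁p p◁s , q◁c)))
    ... | tri> _ _ c◁r = edge-noncrossing (neighbour-after np c◁p) τ (inj₁ (c◁r , r◁p , p◁s))
    noncrossing r s τ (inj₂ (r◁q , q◁s , s◁p)) with ◁-cmp s c
    ... | tri< s◁c _ _ = edge-noncrossing (neighbour-before nq q◁c) τ (inj₂ (r◁q , q◁s , s◁c))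
    ... | tri≈ _ refl _ = between r (inj₂ (inj₁ τ)) (inj₂ (inj₁ (c◁p , ◁-trans r◁q q◁c)))
                                  (inj₂ (inj₂ (◁-trans r◁q q◁c , q◁c , r◁q)))
    ... | tri> _ _ c◁s = edge-noncrossing (neighbour-after np c◁p) τ (inj₂ (◁-trans r◁q q◁c , c◁s , s◁p))
  consecutive⇒edge {c} {p} {q} np nq (inj₂ (inj₂ (p◁c , q◁c , p◁q))) between =
    ¬¬-edge p q p◁q (neighbour-marked np) (neighbour-marked nq) noncrossing >>= λ e → pure (inj₁ e)
    where
    noncrossing : ∀ r s → T r s → ¬ Cross p q r s
    noncrossing r s τ (inj₁ (p◁r , r◁q , q◁s)) with ◁-cmp s c
    ... | tri< s◁c _ _ = edge-noncrossing (neighbour-before nq q◁c) τ (inj₂ (r◁q , q◁s , s◁c))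
    ... | tri≈ _ refl _ = between r (inj₂ (inj₁ τ)) (inj₂ (inj₂ (p◁c , ◁-trans r◁q q◁c , p◁r)))
                                  (inj₂ (inj₂ (◁-trans r◁q q◁c , q◁c , r◁q)))
    ... | tri> _ _ c◁s = edge-noncrossing (neighbour-before np p◁c) τ (inj₁ (p◁r , ◁-trans r◁q q◁c , c◁s))
    noncrossing r s τ (inj₂ (r◁p , p◁s , s◁q)) =
      edge-noncrossing (neighbour-before np p◁c) τ (inj₂ (r◁p , p◁s , ◁-trans s◁q q◁c))

  triangle : ∀ {c p q} → Ang c p q → Pt × Pt × Pt
  triangle {c} {p} {q} (inj₁ _) = c , p , q
  triangle {c} {p} {q} (inj₂ (inj₁ _)) = q , c , p
  triangle {c} {p} {q} (inj₂ (inj₂ _)) = p , q , c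

  Vertex : Pt → Pt × Pt × Pt → Set
  Vertex x (a , b , d) = x ≡ a ⊎ x ≡ b ⊎ x ≡ d

  triangle-vertexˡ : ∀ {c p q} (c∠pq : Ang c p q) → Vertex p (triangle c∠pq)
  triangle-vertexˡ (inj₁ _) = inj₂ (inj₁ refl)
  triangle-vertexˡ (inj₂ (inj₁ _)) = inj₂ (inj₂ refl)
  triangle-vertexˡ (inj₂ (inj₂ _)) = inj₁ refl

  triangle-vertexʳ : ∀ {c p q} (c∠pq : Ang c p q) → Vertex q (triangle c∠pq)
  triangle-vertexʳ (inj₁ _) = inj₂ (inj₂ refl)
  triangle-vertexʳ (inj₂ (inj₁ _)) = inj₁ refl
  triangle-vertexʳ (inj₂ (inj₂ _)) = inj₂ (inj₁ refl)

  triangle-vertices : ∀ {c p q x} (c∠pq : Ang c p q) → Vertex x (triangle c∠pq) → x ≡ c ⊎ x ≡ p ⊎ x ≡ q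
  triangle-vertices (inj₁ _) (inj₁ e) = inj₁ e
  triangle-vertices (inj₁ _) (inj₂ (inj₁ e)) = inj₂ (inj₁ e)
  triangle-vertices (inj₁ _) (inj₂ (inj₂ e)) = inj₂ (inj₂ e)
  triangle-vertices (inj₂ (inj₁ _)) (inj₁ e) = inj₂ (inj₂ e)
  triangle-vertices (inj₂ (inj₁ _)) (inj₂ (inj₁ e)) = inj₁ e
  triangle-vertices (inj₂ (inj₁ _)) (inj₂ (inj₂ e)) = inj₂ (inj₁ e)
  triangle-vertices (inj₂ (inj₂ _)) (inj₁ e) = inj₂ (inj₁ e)
  triangle-vertices (inj₂ (inj₂ _)) (inj₂ (inj₁ e)) = inj₂ (inj₂ e)
  triangle-vertices (inj₂ (inj₂ _)) (inj₂ (inj₂ e)) = inj₁ e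

  triangle-at : ∀ {y p q} → Neighbour (lo y) p → Neighbour (lo y) q → (y∠pq : Ang (lo y) p q) →
                (Ed p q ⊎ Ed q p) → TriangleAt M₂ T y (triangle y∠pq)
  triangle-at np nq (inj₁ (c◁p , c◁q , p◁q)) pq =
    c◁p , p◁q , neighbour-after np c◁p , oriented pq , neighbour-after nq c◁q , inj₁ refl
    where oriented : (Ed _ _ ⊎ Ed _ _) → Ed _ _
          oriented (inj₁ e) = e
          oriented (inj₂ e) = ⊥-elim (◁-asym (edge◁ e) p◁q)
  triangle-at np nq (inj₂ (inj₁ (c◁p , q◁c))) pq =
    q◁c , c◁p , neighbour-before nq q◁c , neighbour-after np c◁p , oriented pq , inj₂ (inj₁ refl)
    where oriented : (Ed _ _ ⊎ Ed _ _) → Ed _ _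
          oriented (inj₁ e) = ⊥-elim (◁-asym (edge◁ e) (◁-trans q◁c c◁p))
          oriented (inj₂ e) = e
  triangle-at np nq (inj₂ (inj₂ (p◁c , q◁c , p◁q))) pq =
    p◁q , q◁c , oriented pq , neighbour-before nq q◁c , neighbour-before np p◁c , inj₂ (inj₂ refl)
    where oriented : (Ed _ _ ⊎ Ed _ _) → Ed _ _
          oriented (inj₁ e) = e
          oriented (inj₂ e) = ⊥-elim (◁-asym (edge◁ e) p◁q)

module Fans (M₂ : ℤ → Set) (T : Pt → Pt → Set) (triangulation : IsTriangulation M₂ T)
            (admissible : Admissible T) {t : ℤ → ℤ → ℤ} (frieze : IsInfiniteFrieze t) where
  open StripGeometry M₂ T triangulation
  open FriezeAlgebra frieze

  UnitEdges : ℤ → ℤ → Set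
  UnitEdges a₀ b₀ = ∀ a b → a₀ ≤ a → a < b → b ≤ b₀ → Ed (lo a) (lo b) → t a b ≡ 1ℤ

  unit-triangle : ∀ {p q r} → t p q ≡ 1ℤ → t q r ≡ 1ℤ → t p r ≡ 1ℤ → ∀ x → t x p + t x r ≡ t x q
  unit-triangle {p} {q} {r} tpq≡1 tqr≡1 tpr≡1 x = begin
    t x p + t x r                   ≡⟨ units (t x p) (t x r) ⟩
    t x p * 1ℤ + 1ℤ * t x r         ≡⟨ cong₂ (λ u v → t x p * u + v * t x r) (sym tqr≡1) (sym tpq≡1) ⟩
    t x p * t q r + t p q * t x r   ≡⟨ plucker x p q r ⟩
    t x q * t p r                   ≡⟨ cong (t x q *_) tpr≡1 ⟩
    t x q * 1ℤ                      ≡⟨ ℤP.*-identityʳ (t x q) ⟩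
    t x q                           ∎
    where
    open ≡-Reasoning
    units : ∀ a b → a + b ≡ a * 1ℤ + 1ℤ * b
    units = solve-∀

  candidates : ℤ → List Pt
  candidates y = lo (y + 1ℤ) ∷ lo (y - 1ℤ) ∷ proj₁ (admissible y)

  candidates-complete : ∀ y x → Neighbour (lo y) x → x ∈ candidates y
  candidates-complete y x (inj₁ (inj₁ τ)) = there (there (proj₂ (admissible y) x (inj₁ τ)))
  candidates-complete y x (inj₁ (inj₂ s)) = here (segment-from-lo s)
  candidates-complete y x (inj₂ (inj₁ τ)) = there (there (proj₂ (admissible y) x (inj₂ τ)))
  candidates-complete y x (inj₂ (inj₂ s)) = there (here (segment-to-lo s))

  ¬¬-nearest : ∀ y (R : Pt → Pt → Set) → (∀ {x} → ¬ R x x) → (∀ {x z w} → R x z → R z w → R x w) →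
               (P : Pt → Set) (cand : Pt) → Neighbour (lo y) cand → P cand →
               ¬ ¬ (Σ Pt λ z → (Neighbour (lo y) z × P z) × (z ≡ cand ⊎ R z cand) ×
                                (∀ x → Neighbour (lo y) x × P x → R x z → ⊥))
  ¬¬-nearest y R irr tr P cand n-cand P-cand =
    ¬¬-minimal R irr tr (λ x → Neighbour (lo y) x × P x) (candidates y) cand (n-cand , P-cand)
               (λ x nPx _ → candidates-complete y x (proj₁ nPx))

  -- The right fan at y up to a neighbour k' > y: the triangles at y with
  -- lower vertices in (y, k'].  Each of them is a unit triangle, so the
  -- Plücker identities telescope along the fan.
  record RightFan (y k' : ℤ) : Set where
    field
      triangles : List (Pt × Pt × Pt)
      distinct  : Unique triangles
      are-triangles : ∀ σ → σ ∈ triangles → TriangleAt M₂ T y σ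
      shape : ∀ σ → σ ∈ triangles →
              Σ ℤ λ q → Σ ℤ λ w → σ ≡ (lo y , lo q , lo w) × y < q × q < w × w ≤ k'
      telescope : ∀ x → t x k' + + length triangles * t x y ≡ t x (y + 1ℤ)
      complete : ∀ u w → y < u → u < w → w ≤ k' → Neighbour (lo y) (lo u) → Neighbour (lo y) (lo w) →
                 (∀ v → u < v → v < w → ¬ Neighbour (lo y) (lo v)) → (lo y , lo u , lo w) ∈ triangles

  -- Built by peeling off the triangle (y, q, k') where q is the last
  -- neighbour of y before k'; n bounds the length k' - y.
  ¬¬-rightFan : ∀ y K → UnitEdges y K → ∀ n k' → y < k' → k' ≤ y + + n → k' ≤ K →
                Neighbour (lo y) (lo k') → ¬ ¬ RightFan y k'
  ¬¬-rightFan y K unit zero k' y<k' k'≤y+0 _ _ =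
    ⊥-elim (ℤP.<-irrefl refl (ℤP.<-≤-trans y<k' (subst (k' ≤_) (i+0≡i y) k'≤y+0)))
  ¬¬-rightFan y K unit (suc n) k' y<k' k'≤y+n+1 k'≤K nk' with k' ℤP.≟ (y + 1ℤ)
  ... | yes refl = pure record
      { triangles = [] ; distinct = [] ; are-triangles = λ _ () ; shape = λ _ ()
      ; telescope = λ x → ℤP.+-identityʳ (t x (y + 1ℤ))
      ; complete = λ u w y<u u<w w≤y+1 _ _ _ → ⊥-elim (noBetween y<u (ℤP.<-≤-trans u<w w≤y+1)) }
  ... | no k'≢y+1 =
    ¬¬-nearest y (λ a b → b ◁ a) ◁-irrefl (λ b◁a c◁b → ◁-trans c◁b b◁a)
               (λ x → lo y ◁ x × x ◁ lo k') (lo (y + 1ℤ)) (inj₁ (inj₂ bl)) (ll (i<i+1 y) , ll y+1<k')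
    >>= λ where
      (up _ , (_ , _ , ()) , _)
      (lo q , (nq , ll y<q , ll q<k') , _ , last) →
        consecutive⇒edge nq nk' (inj₁ (ll y<q , ll y<k' , ll q<k'))
                         (last-before⇒adjacent (ll y<q) (ll y<k') last) >>= λ where
          (inj₂ e) → ⊥-elim (◁-asym (edge◁ e) (ll q<k'))
          (inj₁ eqk') → ¬¬-rightFan y K unit n q y<q (q≤y+n q<k') (ℤP.<⇒≤ (ℤP.<-≤-trans q<k' k'≤K)) nq
                        >>= λ F → pure (extend q y<q q<k' nq last eqk' F)
    where
    y+1<k' : y + 1ℤ < k'
    y+1<k' = ℤP.≤∧≢⇒< (<⇒+1≤ y<k') (λ e → k'≢y+1 (sym e))
    q≤y+n : ∀ {q} → q < k' → q ≤ y + + n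
    q≤y+n q<k' = <+1⇒≤ (ℤP.<-≤-trans q<k' (subst (k' ≤_) (sym (a+n+1 y (+ n))) k'≤y+n+1))
    Last : ℤ → Set
    Last q = ∀ x → Neighbour (lo y) x × (lo y ◁ x × x ◁ lo k') → lo q ◁ x → ⊥
    extend : ∀ q → y < q → q < k' → Neighbour (lo y) (lo q) → Last q → Ed (lo q) (lo k') →
             RightFan y q → RightFan y k'
    extend q y<q q<k' nq last eqk' F = record
      { triangles = τ ∷ F.triangles
      ; distinct = tabulate τ-new ∷ F.distinct
      ; are-triangles = are-triangles
      ; shape = shape
      ; telescope = telescope
      ; complete = complete }
      where
      module F = RightFan F
      τ = (lo y , lo q , lo k')
      eyq = neighbour-after nq (ll y<q)
      eyk' = neighbour-after nk' (ll y<k')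
      q≤K : q ≤ K
      q≤K = ℤP.<⇒≤ (ℤP.<-≤-trans q<k' k'≤K)
      tqk'≡1 = unit q k' (ℤP.<⇒≤ y<q) q<k' k'≤K eqk'
      tyq≡1 = unit y q ℤP.≤-refl y<q q≤K eyq
      tyk'≡1 = unit y k' ℤP.≤-refl y<k' k'≤K eyk'
      are-triangles : ∀ σ → σ ∈ τ ∷ F.triangles → TriangleAt M₂ T y σ
      are-triangles σ (here refl) = ll y<q , ll q<k' , eyq , eqk' , eyk' , inj₁ refl
      are-triangles σ (there σ∈F) = F.are-triangles σ σ∈F
      shape : ∀ σ → σ ∈ τ ∷ F.triangles →
              Σ ℤ λ q' → Σ ℤ λ w → σ ≡ (lo y , lo q' , lo w) × y < q' × q' < w × w ≤ k'
      shape σ (here refl) = q , k' , refl , y<q , q<k' , ℤP.≤-refl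
      shape σ (there σ∈F) with F.shape σ σ∈F
      ... | q' , w , σ≡ , y<q' , q'<w , w≤q = q' , w , σ≡ , y<q' , q'<w , ℤP.≤-trans w≤q (ℤP.<⇒≤ q<k')
      τ-new : ∀ {σ} → σ ∈ F.triangles → τ ≢ σ
      τ-new σ∈F τ≡σ with F.shape _ σ∈F
      ... | q' , w , refl , _ , _ , w≤q =
        ℤP.<-irrefl refl (ℤP.<-≤-trans q<k' (subst (_≤ q) k'≡w w≤q))
        where k'≡w = sym (lo-injective (cong (λ v → proj₂ (proj₂ v)) τ≡σ))
      telescope : ∀ x → t x k' + + length (τ ∷ F.triangles) * t x y ≡ t x (y + 1ℤ)
      telescope x = begin
        t x k' + (1ℤ + + length F.triangles) * t x y      ≡⟨ regroup (t x k') (+ length F.triangles) (t x y) ⟩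
        (t x y + t x k') + + length F.triangles * t x y   ≡⟨ cong (_+ + length F.triangles * t x y)
                                                               (unit-triangle tyq≡1 tqk'≡1 tyk'≡1 x) ⟩
        t x q + + length F.triangles * t x y               ≡⟨ F.telescope x ⟩
        t x (y + 1ℤ)                                       ∎
        where
        open ≡-Reasoning
        regroup : ∀ a L b → a + (1ℤ + L) * b ≡ (b + a) + L * b
        regroup = solve-∀
      complete : ∀ u w → y < u → u < w → w ≤ k' → Neighbour (lo y) (lo u) → Neighbour (lo y) (lo w) →
                 (∀ v → u < v → v < w → ¬ Neighbour (lo y) (lo v)) → (lo y , lo u , lo w) ∈ τ ∷ F.triangles
      complete u w y<u u<w w≤k' nu nw gap with w ℤP.≟ k'
      ... | yes refl = here (cong (λ z → lo y , lo z , lo w) (ℤP.≤-antisym u≤q q≤u))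
        where
        u≤q : u ≤ q
        u≤q = ℤP.≮⇒≥ (λ q<u → last (lo u) (nu , ll y<u , ll u<w) (ll q<u))
        q≤u : q ≤ u
        q≤u = ℤP.≮⇒≥ (λ u<q → gap q u<q q<k' nq)
      ... | no w≢k' = there (F.complete u w y<u u<w w≤q nu nw gap)
        where
        w≤q : w ≤ q
        w≤q = ℤP.≮⇒≥ (λ q<w →
          last (lo w) (nw , ll (ℤP.<-trans y<u u<w) , ll (ℤP.≤∧≢⇒< w≤k' w≢k')) (ll q<w))

  record LeftFan (y i' : ℤ) : Set where
    field
      triangles : List (Pt × Pt × Pt)
      distinct  : Unique triangles
      are-triangles : ∀ σ → σ ∈ triangles → TriangleAt M₂ T y σ
      shape : ∀ σ → σ ∈ triangles →
              Σ ℤ λ p → Σ ℤ λ q → σ ≡ (lo p , lo q , lo y) × i' ≤ p × p < q × q < y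
      telescope : ∀ x → t x i' + + length triangles * t x y ≡ t x (y - 1ℤ)
      complete : ∀ u w → i' ≤ u → u < w → w < y → Neighbour (lo y) (lo u) → Neighbour (lo y) (lo w) →
                 (∀ v → u < v → v < w → ¬ Neighbour (lo y) (lo v)) → (lo u , lo w , lo y) ∈ triangles

  -- Built by peeling off the triangle (i', q, y) where q is the first
  -- neighbour of y after i'; n bounds the length y - i'.
  ¬¬-leftFan : ∀ y K → UnitEdges K y → ∀ n i' → i' < y → y - + n ≤ i' → K ≤ i' →
               Neighbour (lo y) (lo i') → ¬ ¬ LeftFan y i'
  ¬¬-leftFan y K unit zero i' i'<y y-0≤i' _ _ =
    ⊥-elim (ℤP.<-irrefl refl (ℤP.≤-<-trans (subst (_≤ i') (i-0≡i y) y-0≤i') i'<y))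
  ¬¬-leftFan y K unit (suc n) i' i'<y y-n-1≤i' K≤i' ni' with i' ℤP.≟ (y - 1ℤ)
  ... | yes refl = pure record
      { triangles = [] ; distinct = [] ; are-triangles = λ _ () ; shape = λ _ ()
      ; telescope = λ x → ℤP.+-identityʳ (t x (y - 1ℤ))
      ; complete = λ u w y-1≤u u<w w<y _ _ _ →
          ⊥-elim (noBetween (ℤP.≤-<-trans y-1≤u u<w) (subst (w <_) (sym (i-1+1≡i y)) w<y)) }
  ... | no i'≢y-1 =
    ¬¬-nearest y _◁_ ◁-irrefl ◁-trans
               (λ x → x ◁ lo y × lo i' ◁ x) (lo (y - 1ℤ)) (inj₂ (inj₂ (segment-before y))) (ll (i-1<i y) , ll i'<y-1)
    >>= λ where
      (up _ , (_ , () , _) , _)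
      (lo q , (nq , ll q<y , ll i'<q) , _ , first) →
        consecutive⇒edge ni' nq (inj₂ (inj₂ (ll i'<y , ll q<y , ll i'<q)))
                         (first-after⇒adjacent (ll i'<y) first) >>= λ where
          (inj₂ e) → ⊥-elim (◁-asym (edge◁ e) (ll i'<q))
          (inj₁ ei'q) → ¬¬-leftFan y K unit n q q<y (y-n≤q i'<q) (ℤP.≤-trans K≤i' (ℤP.<⇒≤ i'<q)) nq
                        >>= λ F → pure (extend q q<y i'<q nq first ei'q F)
    where
    i'<y-1 : i' < y - 1ℤ
    i'<y-1 = ℤP.≤∧≢⇒< (<⇒≤-1 i'<y) i'≢y-1
    y-n≤q : ∀ {q} → i' < q → y - + n ≤ q
    y-n≤q i'<q = subst (_≤ _) (y-[1+n]+1 y (+ n)) (ℤP.≤-trans (ℤP.+-monoˡ-≤ 1ℤ y-n-1≤i') (<⇒+1≤ i'<q))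
      where y-[1+n]+1 : ∀ y n → y - (1ℤ + n) + 1ℤ ≡ y - n
            y-[1+n]+1 = solve-∀
    First : ℤ → Set
    First q = ∀ x → Neighbour (lo y) x × (x ◁ lo y × lo i' ◁ x) → x ◁ lo q → ⊥
    extend : ∀ q → q < y → i' < q → Neighbour (lo y) (lo q) → First q → Ed (lo i') (lo q) →
             LeftFan y q → LeftFan y i'
    extend q q<y i'<q nq first ei'q F = record
      { triangles = τ ∷ F.triangles
      ; distinct = tabulate τ-new ∷ F.distinct
      ; are-triangles = are-triangles
      ; shape = shape
      ; telescope = telescope
      ; complete = complete }
      where
      module F = LeftFan F
      τ = (lo i' , lo q , lo y)
      eqy = neighbour-before nq (ll q<y)
      ei'y = neighbour-before ni' (ll i'<y)
      K≤q : K ≤ q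
      K≤q = ℤP.≤-trans K≤i' (ℤP.<⇒≤ i'<q)
      tqy≡1 = unit q y K≤q q<y ℤP.≤-refl eqy
      ti'q≡1 = unit i' q K≤i' i'<q (ℤP.<⇒≤ q<y) ei'q
      ti'y≡1 = unit i' y K≤i' i'<y ℤP.≤-refl ei'y
      are-triangles : ∀ σ → σ ∈ τ ∷ F.triangles → TriangleAt M₂ T y σ
      are-triangles σ (here refl) = ll i'<q , ll q<y , ei'q , eqy , ei'y , inj₂ (inj₂ refl)
      are-triangles σ (there σ∈F) = F.are-triangles σ σ∈F
      shape : ∀ σ → σ ∈ τ ∷ F.triangles →
              Σ ℤ λ p → Σ ℤ λ q' → σ ≡ (lo p , lo q' , lo y) × i' ≤ p × p < q' × q' < y
      shape σ (here refl) = i' , q , refl , ℤP.≤-refl , i'<q , q<y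
      shape σ (there σ∈F) with F.shape σ σ∈F
      ... | p , q' , σ≡ , q≤p , p<q' , q'<y = p , q' , σ≡ , ℤP.≤-trans (ℤP.<⇒≤ i'<q) q≤p , p<q' , q'<y
      τ-new : ∀ {σ} → σ ∈ F.triangles → τ ≢ σ
      τ-new σ∈F τ≡σ with F.shape _ σ∈F
      ... | p , q' , refl , q≤p , _ , _ =
        ℤP.<-irrefl refl (ℤP.<-≤-trans i'<q (subst (q ≤_) (sym (lo-injective (cong proj₁ τ≡σ))) q≤p))
      telescope : ∀ x → t x i' + + length (τ ∷ F.triangles) * t x y ≡ t x (y - 1ℤ)
      telescope x = begin
        t x i' + (1ℤ + + length F.triangles) * t x y      ≡⟨ regroup (t x i') (+ length F.triangles) (t x y) ⟩
        (t x i' + t x y) + + length F.triangles * t x y   ≡⟨ cong (_+ + length F.triangles * t x y)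
                                                               (unit-triangle ti'q≡1 tqy≡1 ti'y≡1 x) ⟩
        t x q + + length F.triangles * t x y               ≡⟨ F.telescope x ⟩
        t x (y - 1ℤ)                                       ∎
        where
        open ≡-Reasoning
        regroup : ∀ a L b → a + (1ℤ + L) * b ≡ (a + b) + L * b
        regroup = solve-∀
      complete : ∀ u w → i' ≤ u → u < w → w < y → Neighbour (lo y) (lo u) → Neighbour (lo y) (lo w) →
                 (∀ v → u < v → v < w → ¬ Neighbour (lo y) (lo v)) → (lo u , lo w , lo y) ∈ τ ∷ F.triangles
      complete u w i'≤u u<w w<y nu nw gap with u ℤP.≟ i'
      ... | yes refl = here (cong (λ z → lo u , lo z , lo y) (ℤP.≤-antisym w≤q q≤w))
        where
        q≤w : q ≤ w
        q≤w = ℤP.≮⇒≥ (λ w<q → first (lo w) (nw , ll w<y , ll u<w) (ll w<q))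
        w≤q : w ≤ q
        w≤q = ℤP.≮⇒≥ (λ q<w → gap q i'<q q<w nq)
      ... | no u≢i' = there (F.complete u w q≤u u<w w<y nu nw gap)
        where
        q≤u : q ≤ u
        q≤u = ℤP.≮⇒≥ (λ u<q →
          first (lo u) (nu , ll (ℤP.<-trans u<w w<y) , ll (ℤP.≤∧≢⇒< i'≤u (λ e → u≢i' (sym e)))) (ll u<q))

module Counting (M₂ : ℤ → Set) (T : Pt → Pt → Set) (triangulation : IsTriangulation M₂ T)
                (admissible : Admissible T) (t : ℤ → ℤ → ℤ) (φ : IsΦ M₂ T t) where
  frieze : IsInfiniteFrieze t
  frieze = proj₁ φ
  open IsInfiniteFrieze frieze
  open StripGeometry M₂ T triangulation
  open FriezeAlgebra frieze
  open Fans M₂ T triangulation admissible frieze public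

  quiddity≤ : ∀ y (E : List (Pt × Pt × Pt)) → (∀ σ → TriangleAt M₂ T y σ → σ ∈ E) → quiddity y ≤ + length E
  quiddity≤ y E covers with proj₂ φ y
  ... | n , (L , distinct , length≡n , L⇔) , a≡n =
    subst (_≤ + length E) (trans (cong +_ length≡n) (sym a≡n))
          (+≤+ (unique⊆⇒length≤ L E distinct (λ σ σ∈L → covers σ (Equivalence.to (L⇔ σ) σ∈L))))

  quiddity≥ : ∀ y (E : List (Pt × Pt × Pt)) → Unique E → (∀ σ → σ ∈ E → TriangleAt M₂ T y σ) →
              + length E ≤ quiddity y
  quiddity≥ y E distinctE inside with proj₂ φ y
  ... | n , (L , _ , length≡n , L⇔) , a≡n =
    subst (+ length E ≤_) (trans (cong +_ length≡n) (sym a≡n))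
          (+≤+ (unique⊆⇒length≤ E L distinctE (λ σ σ∈E → Equivalence.from (L⇔ σ) (inside σ σ∈E))))

  ProperUnitEdges : ℤ → ℤ → Set
  ProperUnitEdges i k = ∀ a b → i ≤ a → a < b → b ≤ k → (i < a ⊎ b < k) → Ed (lo a) (lo b) → t a b ≡ 1ℤ

  record ApexFans (i y k : ℤ) : Set where
    field
      i<y : i < y
      y<k : y < k
      edgeˡ : Ed (lo i) (lo y)
      edgeʳ : Ed (lo y) (lo k)
      left : LeftFan y i
      right : RightFan y k
    open LeftFan left renaming (triangles to leftTriangles) using () public
    open RightFan right renaming (triangles to rightTriangles) using () public

  ¬¬-apexFans : ∀ {i y k} → i < y → y < k → Ed (lo i) (lo y) → Ed (lo y) (lo k) → ProperUnitEdges i k →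
                ¬ ¬ ApexFans i y k
  ¬¬-apexFans {i} {y} {k} i<y y<k eiy eyk unit with ≤⇒+ℕ (ℤP.<⇒≤ y<k) | ≤⇒+ℕ (ℤP.<⇒≤ i<y)
  ... | n , k≡y+n | m , y≡i+m =
    ¬¬-rightFan y k unitʳ n k y<k (ℤP.≤-reflexive k≡y+n) ℤP.≤-refl (inj₁ eyk) >>= λ right →
    ¬¬-leftFan y i unitˡ m i i<y (ℤP.≤-reflexive y-m≡i) ℤP.≤-refl (inj₂ eiy) >>= λ left →
    pure (record { i<y = i<y ; y<k = y<k ; edgeˡ = eiy ; edgeʳ = eyk ; left = left ; right = right })
    where
    unitʳ : UnitEdges y k
    unitʳ a b y≤a a<b b≤k = unit a b (ℤP.<⇒≤ (ℤP.<-≤-trans i<y y≤a)) a<b b≤k (inj₁ (ℤP.<-≤-trans i<y y≤a))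
    unitˡ : UnitEdges i y
    unitˡ a b i≤a a<b b≤y = unit a b i≤a a<b (ℤP.≤-trans b≤y (ℤP.<⇒≤ y<k)) (inj₂ (ℤP.≤-<-trans b≤y y<k))
    y-m≡i : y - + m ≡ i
    y-m≡i = trans (cong (_- + m) y≡i+m) (i+m-m i (+ m))
      where i+m-m : ∀ i m → i + m - m ≡ i
            i+m-m = solve-∀

  -- The quiddity at an apex: telescoping both fans from y±1 to k and i.
  quiddity-at-apex : ∀ {i y k} (F : ApexFans i y k) → t y k ≡ 1ℤ →
    quiddity y ≡ t i k + + length (ApexFans.leftTriangles F) + + length (ApexFans.rightTriangles F)
  quiddity-at-apex {i} {y} {k} F tyk≡1 = begin
    t (y - 1ℤ) (y + 1ℤ)                     ≡⟨ sym (RightFan.telescope (ApexFans.right F) (y - 1ℤ)) ⟩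
    t (y - 1ℤ) k + R * t (y - 1ℤ) y         ≡⟨ cong₂ (λ a b → a + R * b) (antisym (y - 1ℤ) k) (adjacent-left y) ⟩
    - t k (y - 1ℤ) + R * 1ℤ                 ≡⟨ cong (λ a → - a + R * 1ℤ) (sym (LeftFan.telescope (ApexFans.left F) k)) ⟩
    - (t k i + L * t k y) + R * 1ℤ          ≡⟨ cong₂ (λ a b → - (a + L * b) + R * 1ℤ) (antisym k i) (antisym k y) ⟩
    - (- t i k + L * - t y k) + R * 1ℤ      ≡⟨ cong (λ b → - (- t i k + L * - b) + R * 1ℤ) tyk≡1 ⟩
    - (- t i k + L * - 1ℤ) + R * 1ℤ         ≡⟨ simplify (t i k) L R ⟩
    t i k + L + R                           ∎
    where
    open ≡-Reasoning
    L = + length (ApexFans.leftTriangles F)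
    R = + length (ApexFans.rightTriangles F)
    simplify : ∀ a L R → - (- a + L * - 1ℤ) + R * 1ℤ ≡ a + L + R
    simplify = solve-∀

module EdgesAreUnits (M₂ : ℤ → Set) (T : Pt → Pt → Set) (triangulation : IsTriangulation M₂ T)
                     (admissible : Admissible T) (t : ℤ → ℤ → ℤ) (φ : IsΦ M₂ T t) where
  open IsTriangulation triangulation
  open StripGeometry M₂ T triangulation
  open Counting M₂ T triangulation admissible t φ
  open IsInfiniteFrieze frieze

  -- An arc (i,k) bounds a triangle (i,y,k) on its inner side: take y the
  -- last neighbour of i before k.
  arc-inner-triangle : ∀ {i k} → T (lo i) (lo k) →
                       ¬ ¬ (Σ ℤ λ y → i < y × y < k × Ed (lo i) (lo y) × Ed (lo y) (lo k))
  arc-inner-triangle {i} {k} τ =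
    ¬¬-nearest i (λ a b → b ◁ a) ◁-irrefl (λ b◁a c◁b → ◁-trans c◁b b◁a)
               (λ x → lo i ◁ x × x ◁ lo k) (lo (i + 1ℤ)) (inj₁ (inj₂ bl)) (ll (i<i+1 i) , ll i+1<k)
    >>= λ where
      (up _ , (_ , _ , ()) , _)
      (lo y , (ny , ll i<y , ll y<k) , _ , last) →
        consecutive⇒edge ny (inj₁ (inj₁ τ)) (inj₁ (ll i<y , ll i<k , ll y<k))
                         (last-before⇒adjacent (ll i<y) (ll i<k) last) >>= λ where
          (inj₂ e) → ⊥-elim (◁-asym (edge◁ e) (ll y<k))
          (inj₁ eyk) → pure (y , i<y , y<k , neighbour-after ny (ll i<y) , eyk)
    where
    i<k : i < k
    i<k = lo◁lo⇒< (proj₁ (arcs _ _ τ))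
    i+1<k : i + 1ℤ < k
    i+1<k = ℤP.≤∧≢⇒< (<⇒+1≤ i<k) (λ i+1≡k → proj₂ (proj₂ (proj₂ (arcs _ _ τ)))
                                              (subst (λ z → BSeg M₂ (lo i) (lo z)) i+1≡k bl))

  -- Below an arc (i,k), a vertex y strictly between only sees lower points
  -- of [i,k]: any other edge at y would cross the arc.
  neighbours-under-arc : ∀ {i y k x} → T (lo i) (lo k) → i < y → y < k → Neighbour (lo y) x →
                         Σ ℤ λ m → x ≡ lo m × i ≤ m × m ≤ k
  neighbours-under-arc {x = up m} τ i<y y<k (inj₁ (inj₁ τ')) =
    ⊥-elim (compatible _ _ _ _ τ τ' (inj₁ (ll i<y , ll y<k , lu)))
  neighbours-under-arc {x = up m} τ i<y y<k (inj₁ (inj₂ s)) with segment-from-lo s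
  ... | ()
  neighbours-under-arc {x = up m} τ i<y y<k (inj₂ e) with edge◁ e
  ... | ()
  neighbours-under-arc {i} {y} {k} {lo m} τ i<y y<k nm with m ℤP.<? i | k ℤP.<? m
  ... | yes m<i | _ = ⊥-elim (compatible _ _ _ _ τ
          (edge⇒arc (neighbour-before nm (ll (ℤP.<-trans m<i i<y))) (ℤP.≤-<-trans (<⇒+1≤ m<i) i<y))
          (inj₂ (ll m<i , ll i<y , ll y<k)))
  ... | no _ | yes k<m = ⊥-elim (compatible _ _ _ _ τ
          (edge⇒arc (neighbour-after nm (ll (ℤP.<-trans y<k k<m))) (ℤP.≤-<-trans (<⇒+1≤ y<k) k<m))
          (inj₁ (ll i<y , ll y<k , ll k<m)))
  ... | no m≮i | no k≮m = m , refl , ℤP.≮⇒≥ m≮i , ℤP.≮⇒≥ k≮m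

  module _ {i y k} (τ : T (lo i) (lo k)) (F : ApexFans i y k) where
    open ApexFans F

    private
      within : ∀ {x} → Neighbour (lo y) x → Σ ℤ λ m → x ≡ lo m × i ≤ m × m ≤ k
      within = neighbours-under-arc τ i<y y<k

    triangles-under-arc : ∀ σ → TriangleAt M₂ T y σ →
                          σ ∈ leftTriangles ++ (lo i , lo y , lo k) ∷ rightTriangles
    triangles-under-arc (a , b , d) (a◁b , b◁d , eab , ebd , ead , inj₁ refl)
      with within (inj₁ eab) | within (inj₁ ead)
    ... | u , refl , _ , _ | w , refl , _ , w≤k =
      ∈P.∈-++⁺ʳ leftTriangles
        (there (RightFan.complete right u w (lo◁lo⇒< a◁b) (lo◁lo⇒< b◁d) w≤k (inj₁ eab) (inj₁ ead) gap))
      where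
      gap : ∀ v → u < v → v < w → ¬ Neighbour (lo y) (lo v)
      gap v u<v v<w nv = edge-noncrossing ebd
        (edge⇒arc (neighbour-after nv (ll (ℤP.<-trans (lo◁lo⇒< a◁b) u<v)))
                  (ℤP.≤-<-trans (<⇒+1≤ (lo◁lo⇒< a◁b)) u<v))
        (inj₂ (a◁b , ll u<v , ll v<w))
    triangles-under-arc (a , b , d) (a◁b , b◁d , eab , ebd , ead , inj₂ (inj₁ refl))
      with within (inj₂ eab) | within (inj₁ ebd)
    ... | u , refl , i≤u , _ | w , refl , _ , w≤k =
      ∈P.∈-++⁺ʳ leftTriangles (here (cong₂ (λ p q → lo p , lo y , lo q) u≡i w≡k))
      where
      τuw : T (lo u) (lo w)
      τuw = edge⇒arc ead (ℤP.≤-<-trans (<⇒+1≤ (lo◁lo⇒< a◁b)) (lo◁lo⇒< b◁d))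
      u≡i : u ≡ i
      u≡i = ℤP.≤-antisym (ℤP.≮⇒≥ (λ i<u → edge-noncrossing edgeˡ τuw (inj₁ (ll i<u , a◁b , b◁d)))) i≤u
      w≡k : w ≡ k
      w≡k = ℤP.≤-antisym w≤k (ℤP.≮⇒≥ (λ w<k → edge-noncrossing edgeʳ τuw (inj₂ (a◁b , b◁d , ll w<k))))
    triangles-under-arc (a , b , d) (a◁b , b◁d , eab , ebd , ead , inj₂ (inj₂ refl))
      with within (inj₂ ead) | within (inj₂ ebd)
    ... | u , refl , i≤u , _ | w , refl , _ , _ =
      ∈P.∈-++⁺ˡ (LeftFan.complete left u w i≤u (lo◁lo⇒< a◁b) (lo◁lo⇒< b◁d) (inj₂ ead) (inj₂ ebd) gap)
      where
      gap : ∀ v → u < v → v < w → ¬ Neighbour (lo y) (lo v)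
      gap v u<v v<w nv = edge-noncrossing eab
        (edge⇒arc (neighbour-before nv (ll (ℤP.<-trans v<w (lo◁lo⇒< b◁d))))
                  (ℤP.≤-<-trans (<⇒+1≤ v<w) (lo◁lo⇒< b◁d)))
        (inj₁ (ll u<v , ll v<w , b◁d))

  -- Counting: a_y = t(i,k) + |L| + |R| ≤ |L| + 1 + |R|, so t(i,k) = 1.
  arc-apex-unit : ∀ {i y k} → T (lo i) (lo k) → ApexFans i y k → t y k ≡ 1ℤ → t i k ≡ 1ℤ
  arc-apex-unit {i} {y} {k} τ F tyk≡1 = ℤP.≤-antisym (cancelSizes bound) (pos i k (ℤP.<-trans i<y y<k))
    where
    open ApexFans F
    L = leftTriangles
    R = rightTriangles
    bound : t i k + + length L + + length R ≤ + length L + (1ℤ + + length R)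
    bound = subst₂ _≤_ (quiddity-at-apex F tyk≡1) length-E
                   (quiddity≤ y (L ++ (lo i , lo y , lo k) ∷ R) (triangles-under-arc τ F))
      where length-E : + length (L ++ (lo i , lo y , lo k) ∷ R) ≡ + length L + (1ℤ + + length R)
            length-E = trans (cong +_ (ListP.length-++ L)) (ℤP.pos-+ (length L) (suc (length R)))

  UnitAtLength : ℕ → Set
  UnitAtLength d = ∀ i k → k ≡ i + + d → Ed (lo i) (lo k) → t i k ≡ 1ℤ

  shorter⇒proper : ∀ {d i k} → (∀ {m} → m ℕ.< d → UnitAtLength m) → k ≡ i + + d → ProperUnitEdges i k
  shorter⇒proper IH k≡i+d a b i≤a a<b b≤k proper eab with shorterSpan k≡i+d i≤a a<b b≤k proper
  ... | m , b≡a+m , m<d = IH m<d a b b≡a+m eab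

  edge⇒unit : ∀ d → UnitAtLength d
  edge⇒unit = <-rec UnitAtLength step
    where
    step : ∀ d → (∀ {m} → m ℕ.< d → UnitAtLength m) → UnitAtLength d
    step d IH i k k≡i+d (inj₂ s) = subst (λ z → t i z ≡ 1ℤ) (sym (lo-injective (segment-from-lo s))) (adj i)
    step d IH i k k≡i+d (inj₁ τ) = decidable-stable (t i k ℤP.≟ 1ℤ) (
      arc-inner-triangle τ >>= λ (y , i<y , y<k , eiy , eyk) →
      ¬¬-apexFans i<y y<k eiy eyk unit >>= λ F →
      pure (arc-apex-unit τ F (unit y k (ℤP.<⇒≤ i<y) y<k ℤP.≤-refl (inj₁ i<y) eyk)))
      where
      unit : ProperUnitEdges i k
      unit = shorter⇒proper IH k≡i+d

  edge-unit : ∀ {a b} → a < b → Ed (lo a) (lo b) → t a b ≡ 1ℤ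
  edge-unit a<b eab with ≤⇒+ℕ (ℤP.<⇒≤ a<b)
  ... | d , b≡a+d = edge⇒unit d _ _ b≡a+d eab

module UnitsAreArcs (M₂ : ℤ → Set) (T : Pt → Pt → Set) (triangulation : IsTriangulation M₂ T)
                    (admissible : Admissible T) (t : ℤ → ℤ → ℤ) (φ : IsΦ M₂ T t) where
  open StripGeometry M₂ T triangulation
  open Counting M₂ T triangulation admissible t φ
  open EdgesAreUnits M₂ T triangulation admissible t φ using (edge-unit)

  Inside : ℤ → ℤ → Pt → Set
  Inside i k x = Σ ℤ λ m → x ≡ lo m × i ≤ m × m ≤ k

  module _ {i y k} (F : ApexFans i y k) where
    open ApexFans F

    fan-vertices-inside : ∀ σ → σ ∈ leftTriangles ++ rightTriangles → ∀ x → Vertex x σ → Inside i k x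
    fan-vertices-inside σ σ∈LR x x∈σ with ∈P.∈-++⁻ leftTriangles σ∈LR
    ... | inj₁ σ∈L with LeftFan.shape left σ σ∈L
    ...   | p , q , refl , i≤p , p<q , q<y with x∈σ
    ...     | inj₁ refl = p , refl , i≤p , ℤP.<⇒≤ (ℤP.<-trans p<q (ℤP.<-trans q<y y<k))
    ...     | inj₂ (inj₁ refl) = q , refl , ℤP.<⇒≤ (ℤP.≤-<-trans i≤p p<q) , ℤP.<⇒≤ (ℤP.<-trans q<y y<k)
    ...     | inj₂ (inj₂ refl) = y , refl , ℤP.<⇒≤ i<y , ℤP.<⇒≤ y<k
    fan-vertices-inside σ σ∈LR x x∈σ | inj₂ σ∈R with RightFan.shape right σ σ∈R
    ...   | q , w , refl , y<q , q<w , w≤k with x∈σ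
    ...     | inj₁ refl = y , refl , ℤP.<⇒≤ i<y , ℤP.<⇒≤ y<k
    ...     | inj₂ (inj₁ refl) = q , refl , ℤP.<⇒≤ (ℤP.<-trans i<y y<q) , ℤP.<⇒≤ (ℤP.<-≤-trans q<w w≤k)
    ...     | inj₂ (inj₂ refl) = w , refl , ℤP.<⇒≤ (ℤP.<-trans i<y (ℤP.<-trans y<q q<w)) , w≤k

    fans-distinct : Unique (leftTriangles ++ rightTriangles)
    fans-distinct = ++⁺ (LeftFan.distinct left) (RightFan.distinct right) disjoint
      where
      disjoint : ∀ {σ} → ¬ (σ ∈ leftTriangles × σ ∈ rightTriangles)
      disjoint (σ∈L , σ∈R) with LeftFan.shape left _ σ∈L | RightFan.shape right _ σ∈R
      ... | p , q , refl , _ , p<q , q<y | _ , _ , σ≡ , _ , _ , _ =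
        ℤP.<-irrefl (lo-injective (cong proj₁ σ≡)) (ℤP.<-trans p<q q<y)

    beyond⇒outside : ∀ {z} → Ang (lo y) (lo k) z → Ang (lo y) z (lo i) → ¬ Inside i k z
    beyond⇒outside (inj₁ (_ , _ , ll k<m)) _ (m , refl , _ , m≤k) = ℤP.<-irrefl refl (ℤP.<-≤-trans k<m m≤k)
    beyond⇒outside (inj₂ (inj₁ (_ , ll m<y))) (inj₁ (y◁m , _ , _)) _ = ◁-asym y◁m (ll m<y)
    beyond⇒outside (inj₂ (inj₁ (_ , ll m<y))) (inj₂ (inj₁ (y◁m , _))) _ = ◁-asym y◁m (ll m<y)
    beyond⇒outside (inj₂ (inj₁ _)) (inj₂ (inj₂ (_ , _ , ll m<i))) (m , refl , i≤m , _) =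
      ℤP.<-irrefl refl (ℤP.<-≤-trans m<i i≤m)
    beyond⇒outside (inj₂ (inj₂ (ll k<y , _ , _))) _ _ = ℤP.<-irrefl refl (ℤP.<-trans k<y y<k)

    -- If y had two more triangles (y,k,z₁), (y,z₁,z₂) beyond k, then
    -- |L| + |R| + 2 ≤ a_y = t(i,k) + |L| + |R|, so t(i,k) ≠ 1.
    two-more-triangles : ∀ {z₁ z₂} → Neighbour (lo y) z₁ → Neighbour (lo y) z₂ →
                         (k∠z₁ : Ang (lo y) (lo k) z₁) → Ang (lo y) z₁ (lo i) → (z₁∠z₂ : Ang (lo y) z₁ z₂) →
                         (Ed (lo k) z₁ ⊎ Ed z₁ (lo k)) → (Ed z₁ z₂ ⊎ Ed z₂ z₁) → t y k ≡ 1ℤ → t i k ≢ 1ℤ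
    two-more-triangles {z₁} {z₂} nz₁ nz₂ k∠z₁ z₁∠i z₁∠z₂ ekz₁ ez₁z₂ tyk≡1 tik≡1 = noRoomForTwo {L} {R} bound
      where
      extra = triangle k∠z₁ ∷ triangle z₁∠z₂ ∷ []
      E = (leftTriangles ++ rightTriangles) ++ extra
      z₁∈extra : ∀ σ → σ ∈ extra → Vertex z₁ σ
      z₁∈extra σ (here refl) = triangle-vertexʳ k∠z₁
      z₁∈extra σ (there (here refl)) = triangle-vertexˡ z₁∠z₂
      extra-distinct : triangle k∠z₁ ≢ triangle z₁∠z₂
      extra-distinct same with triangle-vertices z₁∠z₂ (subst (Vertex (lo k)) same (triangle-vertexˡ k∠z₁))
      ... | inj₁ k≡y = ℤP.<-irrefl (sym (lo-injective k≡y)) y<k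
      ... | inj₂ (inj₁ k≡z₁) = Ang-irrefl (subst (Ang (lo y) (lo k)) (sym k≡z₁) k∠z₁)
      ... | inj₂ (inj₂ k≡z₂) = Ang-irrefl (subst (Ang (lo y) (lo k)) (sym k≡z₂) (Ang-trans k∠z₁ z₁∠z₂))
      E-distinct : Unique E
      E-distinct = ++⁺ fans-distinct ((extra-distinct ∷ []) ∷ [] ∷ [])
        (λ (σ∈LR , σ∈extra) → beyond⇒outside k∠z₁ z₁∠i (fan-vertices-inside _ σ∈LR z₁ (z₁∈extra _ σ∈extra)))
      E-triangles : ∀ σ → σ ∈ E → TriangleAt M₂ T y σ
      E-triangles σ σ∈E with ∈P.∈-++⁻ (leftTriangles ++ rightTriangles) σ∈E
      ... | inj₂ (here refl) = triangle-at (inj₁ edgeʳ) nz₁ k∠z₁ ekz₁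
      ... | inj₂ (there (here refl)) = triangle-at nz₁ nz₂ z₁∠z₂ ez₁z₂
      ... | inj₁ σ∈LR with ∈P.∈-++⁻ leftTriangles σ∈LR
      ...   | inj₁ σ∈L = LeftFan.are-triangles left σ σ∈L
      ...   | inj₂ σ∈R = RightFan.are-triangles right σ σ∈R
      L = + length leftTriangles
      R = + length rightTriangles
      bound : L + R + + 2 ≤ 1ℤ + L + R
      bound = subst₂ _≤_ length-E (trans (quiddity-at-apex F tyk≡1) (cong (λ a → a + L + R) tik≡1))
                     (quiddity≥ y E E-distinct E-triangles)
        where
        length-E : + length E ≡ L + R + + 2
        length-E = trans (cong +_ (trans (ListP.length-++ (leftTriangles ++ rightTriangles))
                                         (cong (ℕ._+ 2) (ListP.length-++ leftTriangles))))
                         (trans (ℤP.pos-+ (length leftTriangles ℕ.+ length rightTriangles) 2)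
                                (cong (_+ + 2) (ℤP.pos-+ (length leftTriangles) (length rightTriangles))))

  -- Otherwise the neighbour z₁ of y following k around y is not i (else
  -- k, i would be consecutive and joined by an edge), and z₁ together with
  -- the next neighbour z₂ gives two triangles too many at y.
  apex⇒arc : ∀ {i y k} → i + 1ℤ < k → t i k ≡ 1ℤ → i < y → y < k →
             Ed (lo i) (lo y) → Ed (lo y) (lo k) → T (lo i) (lo k)
  apex⇒arc {i} {y} {k} i+1<k tik≡1 i<y y<k eiy eyk =
    ¬¬-arc (ll i<k , tt , tt , ¬segment) (λ ¬τ → contradiction ¬τ (λ absurd → absurd))
    where
    i<k : i < k
    i<k = ℤP.<-trans i<y y<k
    ¬segment : ¬ BSeg M₂ (lo i) (lo k)
    ¬segment s = ℤP.<-irrefl (sym (lo-injective (segment-from-lo s))) i+1<k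
    unit : ProperUnitEdges i k
    unit a b _ a<b _ _ eab = edge-unit a<b eab
    contradiction : ¬ T (lo i) (lo k) → ¬ ¬ ⊥
    contradiction ¬τ =
      ¬¬-apexFans i<y y<k eiy eyk unit >>= λ F →
      ¬¬-nearest y (Ang (lo y)) Ang-irrefl Ang-trans (Ang (lo y) (lo k)) (lo i) (inj₂ eiy)
                 (inj₂ (inj₁ (ll y<k , ll i<y))) >>= λ where
        (z₁ , (nz₁ , k∠z₁) , z₁≡i⊎z₁∠i , first₁) →
          consecutive⇒edge (inj₁ eyk) nz₁ k∠z₁ (λ x nx k∠x x∠z₁ → first₁ x (nx , k∠x) x∠z₁) >>= λ ekz₁ →
          beyond F z₁ nz₁ k∠z₁ z₁≡i⊎z₁∠i ekz₁
      where
      beyond : ApexFans i y k → ∀ z₁ → Neighbour (lo y) z₁ → Ang (lo y) (lo k) z₁ →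
               z₁ ≡ lo i ⊎ Ang (lo y) z₁ (lo i) → Ed (lo k) z₁ ⊎ Ed z₁ (lo k) → ¬ ¬ ⊥
      beyond F _ _ _ (inj₁ refl) (inj₁ eki) = pure (◁-asym (edge◁ eki) (ll i<k))
      beyond F _ _ _ (inj₁ refl) (inj₂ (inj₁ τ)) = pure (¬τ τ)
      beyond F _ _ _ (inj₁ refl) (inj₂ (inj₂ s)) = pure (¬segment s)
      beyond F z₁ nz₁ k∠z₁ (inj₂ z₁∠i) ekz₁ =
        ¬¬-nearest y (Ang (lo y)) Ang-irrefl Ang-trans (Ang (lo y) z₁) (lo i) (inj₂ eiy) z₁∠i >>= λ where
          (z₂ , (nz₂ , z₁∠z₂) , _ , first₂) →
            consecutive⇒edge nz₁ nz₂ z₁∠z₂ (λ x nx z₁∠x x∠z₂ → first₂ x (nx , z₁∠x) x∠z₂) >>= λ ez₁z₂ →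
            pure (two-more-triangles F nz₁ nz₂ k∠z₁ z₁∠i z₁∠z₂ ekz₁ ez₁z₂ (edge-unit y<k eyk) tik≡1)

  ArcOrStep : ℤ → ℤ → Set
  ArcOrStep i k = k ≡ i + 1ℤ ⊎ T (lo i) (lo k)

  arcOrStep⇒edge : ∀ {i k} → ArcOrStep i k → Ed (lo i) (lo k)
  arcOrStep⇒edge (inj₁ refl) = inj₂ bl
  arcOrStep⇒edge (inj₂ τ) = inj₁ τ

  ArcAtLength : ℕ → Set
  ArcAtLength d = ∀ i k → k ≡ i + + d → t i k ≡ 1ℤ → ArcOrStep i k

  unit⇒arc : ∀ d → ArcAtLength d
  unit⇒arc = <-rec ArcAtLength step
    where
    step : ∀ d → (∀ {m} → m ℕ.< d → ArcAtLength m) → ArcAtLength d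
    step zero IH i k k≡i+0 tik≡1 = ⊥-elim (0≢1 (begin
      0ℤ     ≡⟨ sym (IsInfiniteFrieze.diag frieze i) ⟩
      t i i  ≡⟨ cong (t i) (sym (trans k≡i+0 (i+0≡i i))) ⟩
      t i k  ≡⟨ tik≡1 ⟩
      1ℤ     ∎))
      where
      open ≡-Reasoning
      0≢1 : 0ℤ ≢ 1ℤ
      0≢1 ()
    step (suc zero) IH i k k≡i+1 tik≡1 = inj₁ k≡i+1
    step (suc (suc d)) IH i k k≡i+d tik≡1 = inj₂ (long-span (Apex.apex frieze i k i+1<k tik≡1))
      where
      i+1<k : i + 1ℤ < k
      i+1<k = subst (i + 1ℤ <_) (sym k≡i+d) (ℤP.+-monoʳ-< i (+<+ (ℕ.s≤s (ℕ.s≤s ℕ.z≤n))))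
      shorter-edge : ∀ {a b} → i ≤ a → a < b → b ≤ k → (i < a ⊎ b < k) → t a b ≡ 1ℤ → Ed (lo a) (lo b)
      shorter-edge i≤a a<b b≤k proper tab≡1 with shorterSpan k≡i+d i≤a a<b b≤k proper
      ... | m , b≡a+m , m<d = arcOrStep⇒edge (IH m<d _ _ b≡a+m tab≡1)
      long-span : (Σ ℤ λ y → i < y × y < k × t i y ≡ 1ℤ × t y k ≡ 1ℤ) → T (lo i) (lo k)
      long-span (y , i<y , y<k , tiy≡1 , tyk≡1) = apex⇒arc i+1<k tik≡1 i<y y<k
        (shorter-edge ℤP.≤-refl i<y (ℤP.<⇒≤ y<k) (inj₂ y<k) tiy≡1)
        (shorter-edge (ℤP.<⇒≤ i<y) y<k ℤP.≤-refl (inj₁ i<y) tyk≡1)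

corollary2p10 : (M₂ : ℤ → Set) (T : Pt → Pt → Set) →
    IsTriangulation M₂ T → Admissible T → NoSpecialUpper M₂ T →
    (t : ℤ → ℤ → ℤ) → IsΦ M₂ T t →
    ∀ i j → i ≤ j → (t i j ≡ 1ℤ ⇔ (j ≡ i + 1ℤ ⊎ T (lo i) (lo j)))
corollary2p10 M₂ T triangulation admissible _ t φ i j i≤j =
  mk⇔ (unit⇒arc d i j j≡i+d) (λ arc → edge⇒unit d i j j≡i+d (arcOrStep⇒edge arc))
  where
  open EdgesAreUnits M₂ T triangulation admissible t φ using (edge⇒unit)
  open UnitsAreArcs M₂ T triangulation admissible t φ using (unit⇒arc; arcOrStep⇒edge)
  d = proj₁ (≤⇒+ℕ i≤j)
  j≡i+d = proj₂ (≤⇒+ℕ i≤j)
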